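{- Let $s,t$ be positive integers with $t<s$. There exists a $\left([t],(2^s-1,2^s)\right)$-flip graph.
   Context: All graphs are finite and simple. For a vertex $v$ and positive integer $j$, $N_j[v]$ is the set of vertices at distance at most $j$ from $v$ (the closed $j$-neighbourhood). For an edge-colouring, $e_{i,j}[v]$ is the number of edges of colour $i$ having both endpoints in $N_j[v]$. For positive integers $b<r$ and $t$, a $([t],(b,r))$-flip graph is a graph $G$ with an edge-colouring $f:E(G)\to\{1,2\}$ such that every vertex is incident with exactly $b$ edges of colour $1$ and exactly $r$ edges of colour $2$, and for every vertex $v$ and every $1\le j\le t$, $e_{2,j}[v]<e_{1,j}[v]$. -}

module Defs where

open import Data.Nat using (ℕ; zero; suc; _<_; _≤_; _∸_; _^_)
open import Data.Bool using (Bool; true; false; _∧_; _∨_; T)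
open import Data.Fin using (Fin; toℕ)
open import Data.List using (List; length; concatMap; map; allFin)
open import Data.Bool.ListAction using (any)
open import Data.List.Base using (filterᵇ)
open import Data.Product using (_×_; _,_; Σ)
open import Relation.Binary.PropositionalEquality using (_≡_)

record Graph (n : ℕ) : Set where
  field
    adj   : Fin n → Fin n → Bool
    sym   : ∀ x y → adj x y ≡ adj y x
    irrefl : ∀ x → adj x x ≡ false
open Graph public

data Colour : Set where
  c1 c2 : Colour

_==ᶜ_ : Colour → Colour → Bool
c1 ==ᶜ c1 = true
c2 ==ᶜ c2 = true
_  ==ᶜ _  = false

-- An edge-colouring f : E(G) → {1,2}: a colour on every ordered pair, symmetric
-- on edges (values on non-edges are irrelevant).
record EdgeColouring {n : ℕ} (G : Graph n) : Set where
  field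
    col    : Fin n → Fin n → Colour
    colSym : ∀ x y → T (adj G x y) → col x y ≡ col y x
open EdgeColouring public

module _ {n : ℕ} (G : Graph n) where

  inBall : ℕ → Fin n → Fin n → Bool
  inBall zero    v u = toℕ v Data.Nat.≡ᵇ toℕ u
  inBall (suc j) v u = inBall j v u ∨ any (λ w → inBall j v w ∧ adj G w u) (allFin n)

  module _ (f : EdgeColouring G) where

    degree : Colour → Fin n → ℕ
    degree i v = length (filterᵇ (λ u → adj G v u ∧ (col f v u ==ᶜ i)) (allFin n))

    pairs : List (Fin n × Fin n)
    pairs = concatMap (λ x → filterᵇ (λ y → toℕ x Data.Nat.<ᵇ toℕ y)
                                      (allFin n) |> map (x ,_)) (allFin n)
      where
        _|>_ : ∀ {A B : Set} → A → (A → B) → B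
        a |> g = g a

    e : Colour → ℕ → Fin n → ℕ
    e i j v = length (filterᵇ (λ { (x , y) → adj G x y ∧ (col f x y ==ᶜ i)
                                              ∧ inBall j v x ∧ inBall j v y }) pairs)

-- G with colouring f is a ([t],(b,r))-flip graph.
-- (The side conditions b < r and b, r, t positive are hypotheses of the notion;
-- they are imposed in the theorem statement.)
IsFlipGraph : {n : ℕ} (G : Graph n) (f : EdgeColouring G) (t b r : ℕ) → Set
IsFlipGraph {n} G f t b r =
    (∀ v → degree G f c1 v ≡ b)
  × (∀ v → degree G f c2 v ≡ r)
  × (∀ v (j : ℕ) → 1 ≤ j → j ≤ t → e G f c2 j v < e G f c1 j v)

-- Take vertices (ℓ, b, a) with ℓ on a cycle ℤ/N of length N = 2t + 3,
-- b < K = 2^(s-1) and a < M = 2^s.  Colour 1 makes every block (ℓ, b) a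
-- clique K_M; colour 2 joins (ℓ, b, a) to all (ℓ ± 1, b', a).  Distances in
-- this graph have an explicit formula, and since N > 2t + 1 a ball of radius
-- j ≤ t never wraps around the cycle.  Counting the edges inside such a ball
-- then gives closed forms for both colours: colour 1 counts whole cliques of
-- blocks strictly inside the ball, while colour 2 loses every edge leaving
-- the outermost layers.  Comparing the two closed forms is a polynomial
-- inequality in K that holds when the radius is less than K, and t < s
-- gives t < 2^(s-1) = K.

module Submission where

open import Algebra.Properties.CommutativeSemigroup using (interchange)
open import Data.Bool using (Bool; true; false; if_then_else_; _∧_; _∨_; not; T)
open import Data.Bool.ListAction using (or)
open import Data.Bool.Properties using (∧-comm; ∧-assoc; ∧-zeroʳ; ∧-identityʳ; ∨-identityʳ; T-≡; T-∧; T-∨)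
open import Data.Empty using (⊥; ⊥-elim)
open import Data.Fin using (Fin; zero; suc; toℕ; fromℕ<; combine; remQuot; _↑ˡ_; _↑ʳ_)
open import Data.Fin.Properties using (toℕ-injective; toℕ<n; toℕ-fromℕ<; remQuot-combine; combine-remQuot)
open import Data.List using (List; []; _∷_; _++_; length; map; filterᵇ; concatMap; tabulate; allFin)
open import Data.List.Properties using (map-cong; filter-++; length-++)
open import Data.Nat
open import Data.Nat.DivMod
open import Data.Nat.Properties
open import Data.Nat.Solver using (module +-*-Solver)
open import Data.Product using (Σ; _×_; _,_; proj₁; proj₂)
open import Data.Sum using (_⊎_; inj₁; inj₂)
open import Function using (_∘_; Equivalence)
open import Relation.Binary.Definitions using (tri<; tri≈; tri>)
open import Relation.Binary.PropositionalEquality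
open import Relation.Nullary.Decidable using (T?)

open import Defs using (Graph; EdgeColouring; Colour; c1; c2; _==ᶜ_; inBall; degree; e; pairs; IsFlipGraph)

open +-*-Solver using (solve; _:+_; _:*_; _:=_; con)

+-interchange : ∀ a b c d → (a + b) + (c + d) ≡ (a + c) + (b + d)
+-interchange = interchange +-commutativeSemigroup

𝟙 : Bool → ℕ
𝟙 true  = 1
𝟙 false = 0

𝟙≤1 : ∀ b → 𝟙 b ≤ 1
𝟙≤1 true  = ≤-refl
𝟙≤1 false = z≤n

𝟙-∧ : ∀ a b → 𝟙 (a ∧ b) ≡ 𝟙 a * 𝟙 b
𝟙-∧ true  b = sym (+-identityʳ (𝟙 b))
𝟙-∧ false b = refl

𝟙-∨ : ∀ a b → (T a → T b → ⊥) → 𝟙 (a ∨ b) ≡ 𝟙 a + 𝟙 b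
𝟙-∨ true  true  disjoint = ⊥-elim (disjoint _ _)
𝟙-∨ true  false _        = refl
𝟙-∨ false b     _        = refl

T-injective : ∀ {a b : Bool} → (T a → T b) → (T b → T a) → a ≡ b
T-injective {true}  {true}  _ _ = refl
T-injective {true}  {false} f _ = ⊥-elim (f _)
T-injective {false} {true}  _ g = ⊥-elim (g _)
T-injective {false} {false} _ _ = refl

T-∧-intro : ∀ {a b} → T a → T b → T (a ∧ b)
T-∧-intro ta tb = Equivalence.from T-∧ (ta , tb)

T-∧-elim : ∀ {a b} → T (a ∧ b) → T a × T b
T-∧-elim = Equivalence.to T-∧

T-∨-introˡ : ∀ {a b} → T a → T (a ∨ b)
T-∨-introˡ t = Equivalence.from T-∨ (inj₁ t)

T-∨-introʳ : ∀ {a b} → T b → T (a ∨ b)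
T-∨-introʳ t = Equivalence.from T-∨ (inj₂ t)

T-∨-elim : ∀ {a b} → T (a ∨ b) → T a ⊎ T b
T-∨-elim = Equivalence.to T-∨

T⇒≡true : ∀ {b} → T b → b ≡ true
T⇒≡true = Equivalence.to T-≡

≡true⇒T : ∀ {b} → b ≡ true → T b
≡true⇒T = Equivalence.from T-≡

≡ᵇ-refl : ∀ x → (x ≡ᵇ x) ≡ true
≡ᵇ-refl x = T⇒≡true (≡⇒≡ᵇ x x refl)

≡ᵇ-sym : ∀ x y → (x ≡ᵇ y) ≡ (y ≡ᵇ x)
≡ᵇ-sym zero    zero    = refl
≡ᵇ-sym zero    (suc y) = refl
≡ᵇ-sym (suc x) zero    = refl
≡ᵇ-sym (suc x) (suc y) = ≡ᵇ-sym x y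

≡ᵇ-true : ∀ {x y} → (x ≡ᵇ y) ≡ true → x ≡ y
≡ᵇ-true {x} {y} eq = ≡ᵇ⇒≡ x y (≡true⇒T eq)

<⇒<ᵇ≡true : ∀ {x y} → x < y → (x <ᵇ y) ≡ true
<⇒<ᵇ≡true lt = T⇒≡true (<⇒<ᵇ lt)

≥⇒<ᵇ≡false : ∀ {x y} → y ≤ x → (x <ᵇ y) ≡ false
≥⇒<ᵇ≡false {x} {y} y≤x with x <ᵇ y in eq
... | false = refl
... | true  = ⊥-elim (<⇒≱ (<ᵇ⇒< x y (≡true⇒T eq)) y≤x)

suc≤ᵇsuc : ∀ r j → (suc r ≤ᵇ suc j) ≡ (r ≤ᵇ j)
suc≤ᵇsuc zero    j = refl
suc≤ᵇsuc (suc r) j = refl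

∑ : ℕ → (ℕ → ℕ) → ℕ
∑ zero    f = 0
∑ (suc n) f = f 0 + ∑ n (f ∘ suc)

∑ᶠ : ∀ {n} → (Fin n → ℕ) → ℕ
∑ᶠ {zero}  f = 0
∑ᶠ {suc n} f = f zero + ∑ᶠ (f ∘ suc)

∑-cong : ∀ n {f g : ℕ → ℕ} → (∀ i → i < n → f i ≡ g i) → ∑ n f ≡ ∑ n g
∑-cong zero    eq = refl
∑-cong (suc n) eq = cong₂ _+_ (eq 0 z<s) (∑-cong n (λ i i<n → eq (suc i) (s<s i<n)))

∑-const : ∀ n c → ∑ n (λ _ → c) ≡ n * c
∑-const zero    c = refl
∑-const (suc n) c = cong (c +_) (∑-const n c)

∑-zero : ∀ n (f : ℕ → ℕ) → (∀ i → i < n → f i ≡ 0) → ∑ n f ≡ 0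
∑-zero n f eq = trans (∑-cong n eq) (trans (∑-const n 0) (*-zeroʳ n))

∑-split : ∀ m n (f : ℕ → ℕ) → ∑ (m + n) f ≡ ∑ m f + ∑ n (λ i → f (m + i))
∑-split zero    n f = refl
∑-split (suc m) n f =
  trans (cong (f 0 +_) (∑-split m n (f ∘ suc))) (sym (+-assoc (f 0) _ _))

∑-last : ∀ n (f : ℕ → ℕ) → ∑ (suc n) f ≡ ∑ n f + f n
∑-last n f = begin
  ∑ (suc n) f                     ≡⟨ cong (λ m → ∑ m f) (+-comm 1 n) ⟩
  ∑ (n + 1) f                     ≡⟨ ∑-split n 1 f ⟩
  ∑ n f + (f (n + 0) + 0)         ≡⟨ cong (λ x → ∑ n f + x) (+-identityʳ _) ⟩
  ∑ n f + f (n + 0)               ≡⟨ cong (λ m → ∑ n f + f m) (+-identityʳ n) ⟩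
  ∑ n f + f n                     ∎
  where open ≡-Reasoning

∑-reverse : ∀ n (f : ℕ → ℕ) → ∑ n f ≡ ∑ n (λ i → f (n ∸ suc i))
∑-reverse zero    f = refl
∑-reverse (suc n) f = begin
  ∑ (suc n) f                            ≡⟨ ∑-last n f ⟩
  ∑ n f + f n                            ≡⟨ +-comm (∑ n f) (f n) ⟩
  f n + ∑ n f                            ≡⟨ cong (f n +_) (∑-reverse n f) ⟩
  f n + ∑ n (λ i → f (n ∸ suc i))        ∎
  where open ≡-Reasoning

∑-distrib-+ : ∀ n (f g : ℕ → ℕ) → ∑ n (λ i → f i + g i) ≡ ∑ n f + ∑ n g
∑-distrib-+ zero    f g = refl
∑-distrib-+ (suc n) f g =
  trans (cong (f 0 + g 0 +_) (∑-distrib-+ n (f ∘ suc) (g ∘ suc))) (+-interchange (f 0) (g 0) _ _)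

∑-*ˡ : ∀ n c (f : ℕ → ℕ) → ∑ n (λ i → c * f i) ≡ c * ∑ n f
∑-*ˡ zero    c f = sym (*-zeroʳ c)
∑-*ˡ (suc n) c f =
  trans (cong (c * f 0 +_) (∑-*ˡ n c (f ∘ suc))) (sym (*-distribˡ-+ c (f 0) _))

∑-*ʳ : ∀ n c (f : ℕ → ℕ) → ∑ n (λ i → f i * c) ≡ ∑ n f * c
∑-*ʳ n c f = trans (∑-cong n (λ i _ → *-comm (f i) c)) (trans (∑-*ˡ n c f) (*-comm c (∑ n f)))

∑-swap : ∀ m n (f : ℕ → ℕ → ℕ) → ∑ m (λ i → ∑ n (f i)) ≡ ∑ n (λ j → ∑ m (λ i → f i j))
∑-swap zero    n f = sym (∑-zero n (λ _ → 0) (λ _ _ → refl))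
∑-swap (suc m) n f =
  trans (cong (∑ n (f 0) +_) (∑-swap m n (f ∘ suc)))
        (sym (∑-distrib-+ n (f 0) (λ j → ∑ m (λ i → f (suc i) j))))

∑-product : ∀ n c (x y : ℕ → ℕ) →
  ∑ n (λ i → ∑ n (λ i' → c * (x i * y i'))) ≡ c * (∑ n x * ∑ n y)
∑-product n c x y = begin
  ∑ n (λ i → ∑ n (λ i' → c * (x i * y i')))
    ≡⟨ ∑-cong n (λ i _ → trans (∑-cong n (λ i' _ → sym (*-assoc c (x i) (y i')))) (∑-*ˡ n (c * x i) y)) ⟩
  ∑ n (λ i → c * x i * ∑ n y)  ≡⟨ ∑-*ʳ n (∑ n y) (λ i → c * x i) ⟩
  ∑ n (λ i → c * x i) * ∑ n y  ≡⟨ cong (_* ∑ n y) (∑-*ˡ n c x) ⟩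
  c * ∑ n x * ∑ n y            ≡⟨ *-assoc c (∑ n x) (∑ n y) ⟩
  c * (∑ n x * ∑ n y)          ∎
  where open ≡-Reasoning

∑-at : ∀ n x (F : ℕ → Bool → ℕ) → x < n → (∀ i → F i false ≡ 0) →
  ∑ n (λ i → F i (x ≡ᵇ i)) ≡ F x true
∑-at (suc n) zero    F _ F0 =
  trans (cong (F 0 true +_) (∑-zero n (λ i → F (suc i) false) (λ i _ → F0 (suc i)))) (+-identityʳ _)
∑-at (suc n) (suc x) F (s≤s x<n) F0 =
  trans (cong (_+ ∑ n (λ i → F (suc i) (x ≡ᵇ i))) (F0 0)) (∑-at n x (F ∘ suc) x<n (F0 ∘ suc))

∑-≡ᵇ : ∀ n x (g : Bool → ℕ) → x < n → ∑ n (λ i → g (x ≡ᵇ i)) ≡ g true + (n ∸ 1) * g false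
∑-≡ᵇ (suc n) zero g _ = cong (g true +_) (∑-const n (g false))
∑-≡ᵇ (suc (suc n)) (suc x) g (s≤s x<n) = begin
  g false + ∑ (suc n) (λ i → g (x ≡ᵇ i))
    ≡⟨ cong (g false +_) (∑-≡ᵇ (suc n) x g x<n) ⟩
  g false + (g true + n * g false)
    ≡⟨ solve 3 (λ a b c → b :+ (a :+ c :* b) := a :+ (b :+ c :* b)) refl (g true) (g false) n ⟩
  g true + (g false + n * g false) ∎
  where open ≡-Reasoning

∑ᶠ-cong : ∀ {n} {f g : Fin n → ℕ} → (∀ i → f i ≡ g i) → ∑ᶠ f ≡ ∑ᶠ g
∑ᶠ-cong {zero}  eq = refl
∑ᶠ-cong {suc n} eq = cong₂ _+_ (eq zero) (∑ᶠ-cong (eq ∘ suc))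

∑ᶠ-toℕ : ∀ n (h : ℕ → ℕ) → ∑ᶠ {n} (h ∘ toℕ) ≡ ∑ n h
∑ᶠ-toℕ zero    h = refl
∑ᶠ-toℕ (suc n) h = cong (h 0 +_) (∑ᶠ-toℕ n (h ∘ suc))

∑ᶠ-distrib-+ : ∀ {n} (f g : Fin n → ℕ) → ∑ᶠ (λ i → f i + g i) ≡ ∑ᶠ f + ∑ᶠ g
∑ᶠ-distrib-+ {zero}  f g = refl
∑ᶠ-distrib-+ {suc n} f g =
  trans (cong (f zero + g zero +_) (∑ᶠ-distrib-+ (f ∘ suc) (g ∘ suc))) (+-interchange (f zero) (g zero) _ _)

∑ᶠ-zero : ∀ n → ∑ᶠ {n} (λ _ → 0) ≡ 0
∑ᶠ-zero zero    = refl
∑ᶠ-zero (suc n) = ∑ᶠ-zero n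

∑ᶠ-swap : ∀ {m n} (f : Fin m → Fin n → ℕ) → ∑ᶠ (λ i → ∑ᶠ (f i)) ≡ ∑ᶠ (λ j → ∑ᶠ (λ i → f i j))
∑ᶠ-swap {zero}  {n} f = sym (∑ᶠ-zero n)
∑ᶠ-swap {suc m} {n} f =
  trans (cong (∑ᶠ (f zero) +_) (∑ᶠ-swap (f ∘ suc)))
        (sym (∑ᶠ-distrib-+ (f zero) (λ j → ∑ᶠ (λ i → f (suc i) j))))

∑ᶠ-↑ : ∀ m k (f : Fin (m + k) → ℕ) → ∑ᶠ f ≡ ∑ᶠ (λ i → f (i ↑ˡ k)) + ∑ᶠ (λ i → f (m ↑ʳ i))
∑ᶠ-↑ zero    k f = refl
∑ᶠ-↑ (suc m) k f = trans (cong (f zero +_) (∑ᶠ-↑ m k (f ∘ suc))) (sym (+-assoc (f zero) _ _))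

∑ᶠ-combine : ∀ m k (f : Fin (m * k) → ℕ) → ∑ᶠ f ≡ ∑ᶠ {m} (λ i → ∑ᶠ {k} (λ j → f (combine i j)))
∑ᶠ-combine zero    k f = refl
∑ᶠ-combine (suc m) k f =
  trans (∑ᶠ-↑ k (m * k) f) (cong (∑ᶠ (λ j → f (j ↑ˡ (m * k))) +_) (∑ᶠ-combine m k (λ i → f (k ↑ʳ i))))

length-filterᵇ-∷ : ∀ {A : Set} (p : A → Bool) x xs →
  length (filterᵇ p (x ∷ xs)) ≡ 𝟙 (p x) + length (filterᵇ p xs)
length-filterᵇ-∷ p x xs with p x
... | true  = refl
... | false = refl

length-filterᵇ-++ : ∀ {A : Set} (p : A → Bool) xs ys →
  length (filterᵇ p (xs ++ ys)) ≡ length (filterᵇ p xs) + length (filterᵇ p ys)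
length-filterᵇ-++ p xs ys = trans (cong length (filter-++ (T? ∘ p) xs ys)) (length-++ (filterᵇ p xs))

length-filterᵇ-tabulate : ∀ {A : Set} {n} (p : A → Bool) (g : Fin n → A) →
  length (filterᵇ p (tabulate g)) ≡ ∑ᶠ (λ i → 𝟙 (p (g i)))
length-filterᵇ-tabulate {n = zero}  p g = refl
length-filterᵇ-tabulate {n = suc n} p g =
  trans (length-filterᵇ-∷ p (g zero) (tabulate (g ∘ suc)))
        (cong (𝟙 (p (g zero)) +_) (length-filterᵇ-tabulate p (g ∘ suc)))

length-filterᵇ-map-filterᵇ : ∀ {A B : Set} {n} (p : B → Bool) (h : A → B) (q : A → Bool) (g : Fin n → A) →
  length (filterᵇ p (map h (filterᵇ q (tabulate g)))) ≡ ∑ᶠ (λ i → 𝟙 (q (g i) ∧ p (h (g i))))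
length-filterᵇ-map-filterᵇ {n = zero}  p h q g = refl
length-filterᵇ-map-filterᵇ {n = suc n} p h q g with q (g zero)
... | true  = trans (length-filterᵇ-∷ p (h (g zero)) _)
                    (cong (𝟙 (p (h (g zero))) +_) (length-filterᵇ-map-filterᵇ p h q (g ∘ suc)))
... | false = length-filterᵇ-map-filterᵇ p h q (g ∘ suc)

length-filterᵇ-concatMap : ∀ {A B : Set} {n} (p : B → Bool) (h : A → List B) (g : Fin n → A) →
  length (filterᵇ p (concatMap h (tabulate g))) ≡ ∑ᶠ (λ i → length (filterᵇ p (h (g i))))
length-filterᵇ-concatMap {n = zero}  p h g = refl
length-filterᵇ-concatMap {n = suc n} p h g =
  trans (length-filterᵇ-++ p (h (g zero)) _)
        (cong (length (filterᵇ p (h (g zero))) +_) (length-filterᵇ-concatMap p h (g ∘ suc)))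

or-map-tabulate-intro : ∀ {A : Set} {n} (p : A → Bool) (g : Fin n → A) x → T (p (g x)) → T (or (map p (tabulate g)))
or-map-tabulate-intro p g zero    t = T-∨-introˡ t
or-map-tabulate-intro p g (suc x) t = T-∨-introʳ {p (g zero)} (or-map-tabulate-intro p (g ∘ suc) x t)

or-map-tabulate-elim : ∀ {A : Set} {n} (p : A → Bool) (g : Fin n → A) →
  T (or (map p (tabulate g))) → Σ (Fin n) (T ∘ p ∘ g)
or-map-tabulate-elim {n = suc n} p g t with T-∨-elim {p (g zero)} t
... | inj₁ t₀ = zero , t₀
... | inj₂ t' with or-map-tabulate-elim p (g ∘ suc) t'
...   | x , tx = suc x , tx

𝟙-split-< : ∀ a b q → (a ≡ b → q ≡ false) → 𝟙 q ≡ 𝟙 ((a <ᵇ b) ∧ q) + 𝟙 ((b <ᵇ a) ∧ q)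
𝟙-split-< a b q diag with <-cmp a b
... | tri< a<b _ _ rewrite <⇒<ᵇ≡true a<b | ≥⇒<ᵇ≡false (<⇒≤ a<b) = sym (+-identityʳ (𝟙 q))
... | tri> _ _ b<a rewrite <⇒<ᵇ≡true b<a | ≥⇒<ᵇ≡false (<⇒≤ b<a) = refl
... | tri≈ _ refl _ rewrite ≥⇒<ᵇ≡false (≤-refl {a}) | diag refl = refl

∑ᶠ-ordered-pairs : ∀ {n} (Q : Fin n → Fin n → Bool) → (∀ x y → Q x y ≡ Q y x) → (∀ x → Q x x ≡ false) →
  2 * ∑ᶠ (λ x → ∑ᶠ (λ y → 𝟙 ((toℕ x <ᵇ toℕ y) ∧ Q x y))) ≡ ∑ᶠ (λ x → ∑ᶠ (λ y → 𝟙 (Q x y)))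
∑ᶠ-ordered-pairs {n} Q Q-sym Q-irrefl = sym (begin
  ∑ᶠ (λ x → ∑ᶠ (λ y → 𝟙 (Q x y)))
    ≡⟨ ∑ᶠ-cong (λ x → ∑ᶠ-cong (λ y → 𝟙-split-< (toℕ x) (toℕ y) (Q x y) (diagonal x y))) ⟩
  ∑ᶠ (λ x → ∑ᶠ (λ y → up x y + down x y))
    ≡⟨ ∑ᶠ-cong (λ x → ∑ᶠ-distrib-+ (up x) (down x)) ⟩
  ∑ᶠ (λ x → ∑ᶠ (up x) + ∑ᶠ (down x))
    ≡⟨ ∑ᶠ-distrib-+ (λ x → ∑ᶠ (up x)) (λ x → ∑ᶠ (down x)) ⟩
  A + ∑ᶠ (λ x → ∑ᶠ (down x))
    ≡⟨ cong (A +_) (∑ᶠ-swap down) ⟩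
  A + ∑ᶠ (λ y → ∑ᶠ (λ x → down x y))
    ≡⟨ cong (A +_) (∑ᶠ-cong (λ y → ∑ᶠ-cong (λ x → cong (λ b → 𝟙 ((toℕ y <ᵇ toℕ x) ∧ b)) (Q-sym x y)))) ⟩
  A + A
    ≡⟨ cong (A +_) (sym (+-identityʳ A)) ⟩
  2 * A ∎)
  where
    open ≡-Reasoning
    up down : Fin n → Fin n → ℕ
    up   x y = 𝟙 ((toℕ x <ᵇ toℕ y) ∧ Q x y)
    down x y = 𝟙 ((toℕ y <ᵇ toℕ x) ∧ Q x y)
    A : ℕ
    A = ∑ᶠ (λ x → ∑ᶠ (up x))
    diagonal : ∀ x y → toℕ x ≡ toℕ y → Q x y ≡ false
    diagonal x y eq = trans (cong (Q x) (sym (toℕ-injective eq))) (Q-irrefl x)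

length-filterᵇ-pairs : ∀ {n} (G : Graph n) (f : EdgeColouring G) (p : Fin n × Fin n → Bool) →
  length (filterᵇ p (pairs G f)) ≡ ∑ᶠ (λ x → ∑ᶠ (λ y → 𝟙 ((toℕ x <ᵇ toℕ y) ∧ p (x , y))))
length-filterᵇ-pairs {n} G f p =
  trans (length-filterᵇ-concatMap p (λ x → map (x ,_) (filterᵇ (λ y → toℕ x <ᵇ toℕ y) (allFin n))) (λ x → x))
        (∑ᶠ-cong (λ x → length-filterᵇ-map-filterᵇ p (x ,_) (λ y → toℕ x <ᵇ toℕ y) (λ y → y)))

double-counting : ∀ {n} (G : Graph n) (f : EdgeColouring G) (p : Fin n × Fin n → Bool) →
  (∀ x y → p (x , y) ≡ p (y , x)) → (∀ x → p (x , x) ≡ false) →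
  2 * length (filterᵇ p (pairs G f)) ≡ ∑ᶠ (λ x → ∑ᶠ (λ y → 𝟙 (p (x , y))))
double-counting G f p p-sym p-irrefl =
  trans (cong (2 *_) (length-filterᵇ-pairs G f p)) (∑ᶠ-ordered-pairs (λ x y → p (x , y)) p-sym p-irrefl)

∣suc-∣≤suc∣-∣ : ∀ b c → ∣ suc b - c ∣ ≤ suc ∣ b - c ∣
∣suc-∣≤suc∣-∣ zero    zero    = ≤-refl
∣suc-∣≤suc∣-∣ (suc b) zero    = ≤-refl
∣suc-∣≤suc∣-∣ zero    (suc c) = m≤n⇒m≤1+n (n≤1+n c)
∣suc-∣≤suc∣-∣ (suc b) (suc c) = ∣suc-∣≤suc∣-∣ b c

∣-∣≤suc∣suc-∣ : ∀ b c → ∣ b - c ∣ ≤ suc ∣ suc b - c ∣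
∣-∣≤suc∣suc-∣ zero    zero    = z≤n
∣-∣≤suc∣suc-∣ (suc b) zero    = m≤n⇒m≤1+n (n≤1+n (suc b))
∣-∣≤suc∣suc-∣ zero    (suc c) = s≤s ≤-refl
∣-∣≤suc∣suc-∣ (suc b) (suc c) = ∣-∣≤suc∣suc-∣ b c

<⇒suc∣suc-∣≡∣-∣ : ∀ p c → p < c → suc ∣ suc p - c ∣ ≡ ∣ p - c ∣
<⇒suc∣suc-∣≡∣-∣ zero    (suc zero)    _         = refl
<⇒suc∣suc-∣≡∣-∣ zero    (suc (suc c)) _         = refl
<⇒suc∣suc-∣≡∣-∣ (suc p) (suc c)       (s≤s p<c) = <⇒suc∣suc-∣≡∣-∣ p c p<c

≤⇒suc∣-∣≡∣suc-∣ : ∀ p c → c ≤ p → suc ∣ p - c ∣ ≡ ∣ suc p - c ∣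
≤⇒suc∣-∣≡∣suc-∣ zero    zero    _         = refl
≤⇒suc∣-∣≡∣suc-∣ (suc p) zero    _         = refl
≤⇒suc∣-∣≡∣suc-∣ (suc p) (suc c) (s≤s c≤p) = ≤⇒suc∣-∣≡∣suc-∣ p c c≤p

∣[c∸i]-c∣≡i : ∀ c i → i ≤ c → ∣ c ∸ i - c ∣ ≡ i
∣[c∸i]-c∣≡i c i i≤c = trans (m≤n⇒∣m-n∣≡n∸m (m∸n≤m c i)) (m∸[m∸n]≡n i≤c)

∣[c+i]-c∣≡i : ∀ c i → ∣ c + i - c ∣ ≡ i
∣[c+i]-c∣≡i c i = trans (∣-∣-comm (c + i) c) (∣m-m+n∣≡n c i)

-- Layers form the cycle ℤ/N with N = 2C + 1.  Distances from a layer ℓ₀ are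
-- measured by rotating ℓ₀ to the midpoint C, where position p has distance
-- |p - C|.
module Cycle (C₁ : ℕ) where

  C N : ℕ
  C = suc C₁
  N = suc (C + C)

  shift : ℕ → ℕ → ℕ
  shift c x = (x + c) % N

  next prev : ℕ → ℕ
  next = shift 1
  prev = shift (C + C)

  [m%N+n]%N≡[m+n]%N : ∀ m n → (m % N + n) % N ≡ (m + n) % N
  [m%N+n]%N≡[m+n]%N m n = begin
    (m % N + n) % N          ≡⟨ %-distribˡ-+ (m % N) n N ⟩
    (m % N % N + n % N) % N  ≡⟨ cong (λ z → (z + n % N) % N) (m%n%n≡m%n m N) ⟩
    (m % N + n % N) % N      ≡⟨ sym (%-distribˡ-+ m n N) ⟩
    (m + n) % N              ∎
    where open ≡-Reasoning

  shift-shift : ∀ c d x → shift c (shift d x) ≡ shift (d + c) x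
  shift-shift c d x = trans ([m%N+n]%N≡[m+n]%N (x + d) c) (cong (_% N) (+-assoc x d c))

  shift-comm : ∀ c d x → shift c (shift d x) ≡ shift d (shift c x)
  shift-comm c d x =
    trans (shift-shift c d x) (trans (cong (λ z → shift z x) (+-comm d c)) (sym (shift-shift d c x)))

  shift<N : ∀ c x → shift c x < N
  shift<N c x = m%n<n (x + c) N

  shift-inverse : ∀ c x → c ≤ N → x < N → shift (N ∸ c) (shift c x) ≡ x
  shift-inverse c x c≤N x<N = begin
    shift (N ∸ c) (shift c x)  ≡⟨ shift-shift (N ∸ c) c x ⟩
    (x + (c + (N ∸ c))) % N    ≡⟨ cong (λ z → (x + z) % N) (m+[n∸m]≡n c≤N) ⟩
    (x + N) % N                ≡⟨ [m+n]%n≡m%n x N ⟩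
    x % N                      ≡⟨ m<n⇒m%n≡m x<N ⟩
    x                          ∎
    where open ≡-Reasoning

  next<N : ∀ x → next x < N
  next<N = shift<N 1

  prev<N : ∀ x → prev x < N
  prev<N = shift<N (C + C)

  prev-next : ∀ x → x < N → prev (next x) ≡ x
  prev-next x x<N = shift-inverse 1 x (s≤s z≤n) x<N

  next-prev : ∀ x → x < N → next (prev x) ≡ x
  next-prev x x<N =
    trans (cong (λ c → shift c (prev x)) (sym (m+n∸n≡m 1 (C + C)))) (shift-inverse (C + C) x (n≤1+n _) x<N)

  next-< : ∀ p → p < C + C → next p ≡ suc p
  next-< p p< = trans (cong (_% N) (+-comm p 1)) (m<n⇒m%n≡m (s≤s p<))

  next-top : next (C + C) ≡ 0
  next-top = trans (cong (_% N) (+-comm (C + C) 1)) (n%n≡0 N)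

  prev-suc : ∀ p → suc p < N → prev (suc p) ≡ p
  prev-suc p p<N = trans (cong prev (sym (next-< p (≤-pred p<N)))) (prev-next p (<-trans (n<1+n p) p<N))

  prev-zero : prev 0 ≡ C + C
  prev-zero = m<n⇒m%n≡m (n<1+n (C + C))

  next≢id : ∀ x → x < N → next x ≢ x
  next≢id x x<N eq with m≤n⇒m<n∨m≡n (≤-pred x<N)
  ... | inj₁ x<top = 1+n≢n (trans (sym (next-< x x<top)) eq)
  ... | inj₂ refl  = 0≢1+n (trans (sym next-top) eq)

  C+C≢1 : C + C ≢ 1
  C+C≢1 eq = 0≢1+n (sym (suc-injective (trans (sym (+-suc C C₁)) eq)))

  next²≢id : ∀ x → x < N → next (next x) ≢ x
  next²≢id x x<N eq with m≤n⇒m<n∨m≡n (≤-pred x<N)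
  ... | inj₂ refl = C+C≢1 (begin
    C + C              ≡⟨ sym eq ⟩
    next (next (C + C)) ≡⟨ cong next next-top ⟩
    next 0             ≡⟨ next-< 0 (≤-trans (s≤s z≤n) (m≤m+n C C)) ⟩
    1                  ∎)
    where open ≡-Reasoning
  ... | inj₁ x<top with m≤n⇒m<n∨m≡n x<top
  ...   | inj₁ sx<top =
    <⇒≢ (m<n⇒m<1+n (n<1+n x)) (sym (trans (sym (trans (cong next (next-< x x<top)) (next-< (suc x) sx<top))) eq))
  ...   | inj₂ sx≡top = C+C≢1 (begin
    C + C   ≡⟨ sym sx≡top ⟩
    suc x   ≡⟨ cong suc (sym (trans (sym (trans (cong next (trans (next-< x x<top) sx≡top)) next-top)) eq)) ⟩
    1       ∎)
    where open ≡-Reasoning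

  offset : ℕ → ℕ
  offset ℓ₀ = (C + (N ∸ ℓ₀)) % N

  offset≤N : ∀ ℓ₀ → offset ℓ₀ ≤ N
  offset≤N ℓ₀ = m%n≤n (C + (N ∸ ℓ₀)) N

  recentre : ℕ → ℕ → ℕ
  recentre ℓ₀ = shift (offset ℓ₀)

  recentre<N : ∀ ℓ₀ ℓ → recentre ℓ₀ ℓ < N
  recentre<N ℓ₀ = shift<N (offset ℓ₀)

  recentre-self : ∀ ℓ₀ → ℓ₀ < N → recentre ℓ₀ ℓ₀ ≡ C
  recentre-self ℓ₀ ℓ₀<N = begin
    (ℓ₀ + offset ℓ₀) % N          ≡⟨ cong (_% N) (+-comm ℓ₀ _) ⟩
    (offset ℓ₀ + ℓ₀) % N          ≡⟨ [m%N+n]%N≡[m+n]%N (C + (N ∸ ℓ₀)) ℓ₀ ⟩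
    (C + (N ∸ ℓ₀) + ℓ₀) % N       ≡⟨ cong (_% N) (trans (+-assoc C _ ℓ₀) (cong (C +_) (m∸n+n≡m (<⇒≤ ℓ₀<N)))) ⟩
    (C + N) % N                   ≡⟨ [m+n]%n≡m%n C N ⟩
    C % N                         ≡⟨ m<n⇒m%n≡m (s≤s (m≤m+n C C)) ⟩
    C                             ∎
    where open ≡-Reasoning

  recentre-injective : ∀ ℓ₀ {ℓ ℓ'} → ℓ < N → ℓ' < N → recentre ℓ₀ ℓ ≡ recentre ℓ₀ ℓ' → ℓ ≡ ℓ'
  recentre-injective ℓ₀ {ℓ} {ℓ'} ℓ<N ℓ'<N eq = begin
    ℓ                                              ≡⟨ sym (shift-inverse (offset ℓ₀) ℓ (offset≤N ℓ₀) ℓ<N) ⟩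
    shift (N ∸ offset ℓ₀) (recentre ℓ₀ ℓ)          ≡⟨ cong (shift (N ∸ offset ℓ₀)) eq ⟩
    shift (N ∸ offset ℓ₀) (recentre ℓ₀ ℓ')         ≡⟨ shift-inverse (offset ℓ₀) ℓ' (offset≤N ℓ₀) ℓ'<N ⟩
    ℓ'                                             ∎
    where open ≡-Reasoning

  recentre-next : ∀ ℓ₀ ℓ → recentre ℓ₀ (next ℓ) ≡ next (recentre ℓ₀ ℓ)
  recentre-next ℓ₀ = shift-comm (offset ℓ₀) 1

  recentre-prev : ∀ ℓ₀ ℓ → recentre ℓ₀ (prev ℓ) ≡ prev (recentre ℓ₀ ℓ)
  recentre-prev ℓ₀ = shift-comm (offset ℓ₀) (C + C)

  ∑-shift : ∀ c (f : ℕ → ℕ) → c ≤ N → ∑ N (f ∘ shift c) ≡ ∑ N f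
  ∑-shift c f c≤N = begin
    ∑ N (f ∘ shift c)
      ≡⟨ cong (λ m → ∑ m (f ∘ shift c)) (sym (m∸n+n≡m c≤N)) ⟩
    ∑ ((N ∸ c) + c) (f ∘ shift c)
      ≡⟨ ∑-split (N ∸ c) c _ ⟩
    ∑ (N ∸ c) (f ∘ shift c) + ∑ c (λ i → f (shift c (N ∸ c + i)))
      ≡⟨ cong₂ _+_ (∑-cong (N ∸ c) (λ x x< → cong f (m<n⇒m%n≡m (below x x<))))
                   (∑-cong c (λ i i<c → cong f (wraps i i<c))) ⟩
    ∑ (N ∸ c) (λ x → f (x + c)) + ∑ c f
      ≡⟨ +-comm _ (∑ c f) ⟩
    ∑ c f + ∑ (N ∸ c) (λ x → f (x + c))
      ≡⟨ cong (∑ c f +_) (∑-cong (N ∸ c) (λ x _ → cong f (+-comm x c))) ⟩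
    ∑ c f + ∑ (N ∸ c) (λ x → f (c + x))
      ≡⟨ sym (∑-split c (N ∸ c) f) ⟩
    ∑ (c + (N ∸ c)) f
      ≡⟨ cong (λ m → ∑ m f) (m+[n∸m]≡n c≤N) ⟩
    ∑ N f ∎
    where
      open ≡-Reasoning
      below : ∀ x → x < N ∸ c → x + c < N
      below x x< = subst (x + c <_) (m∸n+n≡m c≤N) (+-monoˡ-< c x<)
      wraps : ∀ i → i < c → shift c (N ∸ c + i) ≡ i
      wraps i i<c = begin
        (N ∸ c + i + c) % N  ≡⟨ cong (_% N) (solve 3 (λ a b d → a :+ b :+ d := b :+ (a :+ d)) refl (N ∸ c) i c) ⟩
        (i + (N ∸ c + c)) % N ≡⟨ cong (λ z → (i + z) % N) (m∸n+n≡m c≤N) ⟩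
        (i + N) % N          ≡⟨ [m+n]%n≡m%n i N ⟩
        i % N                ≡⟨ m<n⇒m%n≡m (≤-trans i<c c≤N) ⟩
        i                    ∎

  ∑-recentre : ∀ ℓ₀ (f : ℕ → ℕ) → ∑ N (f ∘ recentre ℓ₀) ≡ ∑ N f
  ∑-recentre ℓ₀ f = ∑-shift (offset ℓ₀) f (offset≤N ℓ₀)

  adjLayer : ℕ → ℕ → Bool
  adjLayer ℓ ℓ' = (next ℓ ≡ᵇ ℓ') ∨ (prev ℓ ≡ᵇ ℓ')

  next≢prev : ∀ x → x < N → next x ≢ prev x
  next≢prev x x<N eq = next²≢id x x<N (trans (cong next eq) (next-prev x x<N))

  ∑-adjLayer : ∀ ℓ (g : ℕ → ℕ) → ℓ < N →
    ∑ N (λ ℓ' → 𝟙 (adjLayer ℓ ℓ') * g ℓ') ≡ g (next ℓ) + g (prev ℓ)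
  ∑-adjLayer ℓ g ℓ<N = begin
    ∑ N (λ ℓ' → 𝟙 (adjLayer ℓ ℓ') * g ℓ')
      ≡⟨ ∑-cong N (λ ℓ' _ → trans (cong (_* g ℓ') (𝟙-∨ (next ℓ ≡ᵇ ℓ') (prev ℓ ≡ᵇ ℓ') (disjoint ℓ')))
                                   (*-distribʳ-+ (g ℓ') (𝟙 (next ℓ ≡ᵇ ℓ')) (𝟙 (prev ℓ ≡ᵇ ℓ')))) ⟩
    ∑ N (λ ℓ' → 𝟙 (next ℓ ≡ᵇ ℓ') * g ℓ' + 𝟙 (prev ℓ ≡ᵇ ℓ') * g ℓ')
      ≡⟨ ∑-distrib-+ N (λ ℓ' → 𝟙 (next ℓ ≡ᵇ ℓ') * g ℓ') (λ ℓ' → 𝟙 (prev ℓ ≡ᵇ ℓ') * g ℓ') ⟩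
    ∑ N (λ ℓ' → 𝟙 (next ℓ ≡ᵇ ℓ') * g ℓ') + ∑ N (λ ℓ' → 𝟙 (prev ℓ ≡ᵇ ℓ') * g ℓ')
      ≡⟨ cong₂ _+_ (∑-at N (next ℓ) (λ ℓ' b → 𝟙 b * g ℓ') (next<N ℓ) (λ _ → refl))
                   (∑-at N (prev ℓ) (λ ℓ' b → 𝟙 b * g ℓ') (prev<N ℓ) (λ _ → refl)) ⟩
    1 * g (next ℓ) + 1 * g (prev ℓ)
      ≡⟨ cong₂ _+_ (*-identityˡ (g (next ℓ))) (*-identityˡ (g (prev ℓ))) ⟩
    g (next ℓ) + g (prev ℓ) ∎
    where
      open ≡-Reasoning
      disjoint : ∀ ℓ' → T (next ℓ ≡ᵇ ℓ') → T (prev ℓ ≡ᵇ ℓ') → ⊥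
      disjoint ℓ' t t' = next≢prev ℓ ℓ<N (trans (≡ᵇ⇒≡ (next ℓ) ℓ' t) (sym (≡ᵇ⇒≡ (prev ℓ) ℓ' t')))

  ∑-𝟙-adjLayer : ∀ ℓ → ℓ < N → ∑ N (λ ℓ' → 𝟙 (adjLayer ℓ ℓ')) ≡ 2
  ∑-𝟙-adjLayer ℓ ℓ<N = trans (∑-cong N (λ ℓ' _ → sym (*-identityʳ (𝟙 (adjLayer ℓ ℓ'))))) (∑-adjLayer ℓ (λ _ → 1) ℓ<N)

  ∑-adjLayer-pairs : ∀ ℓ₀ (U : ℕ → ℕ) →
    ∑ N (λ ℓ → ∑ N (λ ℓ' → 𝟙 (adjLayer ℓ ℓ') * (U (recentre ℓ₀ ℓ) * U (recentre ℓ₀ ℓ'))))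
      ≡ 2 * ∑ N (λ p → U p * U (next p))
  ∑-adjLayer-pairs ℓ₀ U = begin
    ∑ N (λ ℓ → ∑ N (λ ℓ' → 𝟙 (adjLayer ℓ ℓ') * (U (recentre ℓ₀ ℓ) * U (recentre ℓ₀ ℓ'))))
      ≡⟨ ∑-cong N (λ ℓ ℓ<N → trans (∑-adjLayer ℓ (λ ℓ' → U (recentre ℓ₀ ℓ) * U (recentre ℓ₀ ℓ')) ℓ<N)
            (cong₂ (λ a b → U (recentre ℓ₀ ℓ) * U a + U (recentre ℓ₀ ℓ) * U b)
                   (recentre-next ℓ₀ ℓ) (recentre-prev ℓ₀ ℓ))) ⟩
    ∑ N ((λ p → U p * U (next p) + U p * U (prev p)) ∘ recentre ℓ₀)
      ≡⟨ ∑-recentre ℓ₀ (λ p → U p * U (next p) + U p * U (prev p)) ⟩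
    ∑ N (λ p → U p * U (next p) + U p * U (prev p))
      ≡⟨ ∑-distrib-+ N (λ p → U p * U (next p)) (λ p → U p * U (prev p)) ⟩
    A + ∑ N (λ p → U p * U (prev p))
      ≡⟨ cong (A +_) (sym (∑-shift 1 (λ p → U p * U (prev p)) (s≤s z≤n))) ⟩
    A + ∑ N (λ p → U (next p) * U (prev (next p)))
      ≡⟨ cong (A +_) (∑-cong N (λ p p<N →
           trans (cong (λ z → U (next p) * U z) (prev-next p p<N)) (*-comm (U (next p)) (U p)))) ⟩
    A + A
      ≡⟨ cong (A +_) (sym (+-identityʳ A)) ⟩
    2 * A ∎
    where
      open ≡-Reasoning
      A = ∑ N (λ p → U p * U (next p))

  adjLayer-next : ∀ ℓ → T (adjLayer ℓ (next ℓ))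
  adjLayer-next ℓ = T-∨-introˡ (≡⇒≡ᵇ (next ℓ) (next ℓ) refl)

  adjLayer-prev : ∀ ℓ → T (adjLayer ℓ (prev ℓ))
  adjLayer-prev ℓ = T-∨-introʳ {next ℓ ≡ᵇ prev ℓ} (≡⇒≡ᵇ (prev ℓ) (prev ℓ) refl)

  adjLayer-symmetric : ∀ ℓ ℓ' → ℓ < N → ℓ' < N → T (adjLayer ℓ ℓ') → T (adjLayer ℓ' ℓ)
  adjLayer-symmetric ℓ ℓ' ℓ<N ℓ'<N t with T-∨-elim {next ℓ ≡ᵇ ℓ'} t
  ... | inj₁ t₁ rewrite sym (≡ᵇ⇒≡ (next ℓ) ℓ' t₁) =
    subst (T ∘ adjLayer (next ℓ)) (prev-next ℓ ℓ<N) (adjLayer-prev (next ℓ))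
  ... | inj₂ t₂ rewrite sym (≡ᵇ⇒≡ (prev ℓ) ℓ' t₂) =
    subst (T ∘ adjLayer (prev ℓ)) (next-prev ℓ ℓ<N) (adjLayer-next (prev ℓ))

  adjLayer-sym : ∀ ℓ ℓ' → ℓ < N → ℓ' < N → adjLayer ℓ ℓ' ≡ adjLayer ℓ' ℓ
  adjLayer-sym ℓ ℓ' ℓ<N ℓ'<N = T-injective (adjLayer-symmetric ℓ ℓ' ℓ<N ℓ'<N) (adjLayer-symmetric ℓ' ℓ ℓ'<N ℓ<N)

  adjLayer-irrefl : ∀ ℓ → ℓ < N → adjLayer ℓ ℓ ≡ false
  adjLayer-irrefl ℓ ℓ<N = T-injective loop (λ ())
    where
      loop : T (adjLayer ℓ ℓ) → T false
      loop t with T-∨-elim {next ℓ ≡ᵇ ℓ} t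
      ... | inj₁ t₁ = next≢id ℓ ℓ<N (≡ᵇ⇒≡ (next ℓ) ℓ t₁)
      ... | inj₂ t₂ = next≢id ℓ ℓ<N (trans (cong next (sym (≡ᵇ⇒≡ (prev ℓ) ℓ t₂))) (next-prev ℓ ℓ<N))

  layerDist : ℕ → ℕ → ℕ
  layerDist ℓ₀ ℓ = ∣ recentre ℓ₀ ℓ - C ∣

  layerDist-self : ∀ ℓ₀ → ℓ₀ < N → layerDist ℓ₀ ℓ₀ ≡ 0
  layerDist-self ℓ₀ ℓ₀<N = trans (cong (λ p → ∣ p - C ∣) (recentre-self ℓ₀ ℓ₀<N)) (∣n-n∣≡0 C)

  layerDist≡0⇒≡ : ∀ ℓ₀ ℓ → ℓ₀ < N → ℓ < N → layerDist ℓ₀ ℓ ≡ 0 → ℓ ≡ ℓ₀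
  layerDist≡0⇒≡ ℓ₀ ℓ ℓ₀<N ℓ<N eq =
    recentre-injective ℓ₀ ℓ<N ℓ₀<N (trans (∣m-n∣≡0⇒m≡n eq) (sym (recentre-self ℓ₀ ℓ₀<N)))

  layerDist-next-self : ∀ ℓ₀ → ℓ₀ < N → layerDist ℓ₀ (next ℓ₀) ≡ 1
  layerDist-next-self ℓ₀ ℓ₀<N = begin
    ∣ recentre ℓ₀ (next ℓ₀) - C ∣
      ≡⟨ cong (λ p → ∣ p - C ∣) (trans (recentre-next ℓ₀ ℓ₀) (cong next (recentre-self ℓ₀ ℓ₀<N))) ⟩
    ∣ next C - C ∣                 ≡⟨ cong (λ p → ∣ p - C ∣) (next-< C (m<m+n C (s≤s z≤n))) ⟩
    ∣ suc C - C ∣                  ≡⟨ trans (m≤n⇒∣n-m∣≡n∸m (n≤1+n C)) (m+n∸n≡m 1 C) ⟩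
    1                              ∎
    where open ≡-Reasoning

  ∣next-C∣≤suc∣-C∣ : ∀ p → p < N → ∣ next p - C ∣ ≤ suc ∣ p - C ∣
  ∣next-C∣≤suc∣-C∣ p p<N with m≤n⇒m<n∨m≡n (≤-pred p<N)
  ... | inj₁ p<top rewrite next-< p p<top = ∣suc-∣≤suc∣-∣ p C
  ... | inj₂ refl  rewrite next-top | ∣[c+i]-c∣≡i C C = n≤1+n C

  ∣prev-C∣≤suc∣-C∣ : ∀ p → p < N → ∣ prev p - C ∣ ≤ suc ∣ p - C ∣
  ∣prev-C∣≤suc∣-C∣ zero    _   rewrite prev-zero | ∣[c+i]-c∣≡i C C = n≤1+n C
  ∣prev-C∣≤suc∣-C∣ (suc p) p<N rewrite prev-suc p p<N = ∣-∣≤suc∣suc-∣ p C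

  layerDist-adj : ∀ ℓ₀ ℓ ℓ' → T (adjLayer ℓ ℓ') → layerDist ℓ₀ ℓ' ≤ suc (layerDist ℓ₀ ℓ)
  layerDist-adj ℓ₀ ℓ ℓ' t with T-∨-elim {next ℓ ≡ᵇ ℓ'} t
  ... | inj₁ t₁ rewrite sym (≡ᵇ⇒≡ (next ℓ) ℓ' t₁) | recentre-next ℓ₀ ℓ =
    ∣next-C∣≤suc∣-C∣ (recentre ℓ₀ ℓ) (recentre<N ℓ₀ ℓ)
  ... | inj₂ t₂ rewrite sym (≡ᵇ⇒≡ (prev ℓ) ℓ' t₂) | recentre-prev ℓ₀ ℓ =
    ∣prev-C∣≤suc∣-C∣ (recentre ℓ₀ ℓ) (recentre<N ℓ₀ ℓ)

  layerDist-closer : ∀ ℓ₀ ℓ d → ℓ < N → layerDist ℓ₀ ℓ ≡ suc d →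
    Σ ℕ (λ ℓ' → ℓ' < N × T (adjLayer ℓ' ℓ) × layerDist ℓ₀ ℓ' ≡ d)
  layerDist-closer ℓ₀ ℓ d ℓ<N eq with <-cmp (recentre ℓ₀ ℓ) C
  ... | tri< p<C _ _ =
    next ℓ , next<N ℓ , adjLayer-symmetric ℓ (next ℓ) ℓ<N (next<N ℓ) (adjLayer-next ℓ) ,
    suc-injective (begin
      suc ∣ recentre ℓ₀ (next ℓ) - C ∣
        ≡⟨ cong (λ p → suc ∣ p - C ∣) (trans (recentre-next ℓ₀ ℓ) (next-< _ (<-≤-trans p<C (m≤m+n C C)))) ⟩
      suc ∣ suc (recentre ℓ₀ ℓ) - C ∣   ≡⟨ <⇒suc∣suc-∣≡∣-∣ _ C p<C ⟩
      ∣ recentre ℓ₀ ℓ - C ∣             ≡⟨ eq ⟩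
      suc d                             ∎)
    where open ≡-Reasoning
  ... | tri≈ _ p≡C _ = ⊥-elim (0≢1+n (trans (sym (trans (cong (λ p → ∣ p - C ∣) p≡C) (∣n-n∣≡0 C))) eq))
  ... | tri> _ _ C<p =
    prev ℓ , prev<N ℓ , adjLayer-symmetric ℓ (prev ℓ) ℓ<N (prev<N ℓ) (adjLayer-prev ℓ) ,
    suc-injective (trans (cong (λ p → suc ∣ p - C ∣) (recentre-prev ℓ₀ ℓ))
                         (trans (stepDown (recentre ℓ₀ ℓ) C<p (recentre<N ℓ₀ ℓ)) eq))
    where
      stepDown : ∀ p → C < p → p < N → suc ∣ prev p - C ∣ ≡ ∣ p - C ∣
      stepDown (suc p) (s≤s C≤p) p<N rewrite prev-suc p p<N = ≤⇒suc∣-∣≡∣suc-∣ p C C≤p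

  N≡C+sucC : N ≡ C + suc C
  N≡C+sucC = sym (+-suc C C)

  ∑-∣-C∣ : ∀ (F : ℕ → ℕ) → ∑ N (λ p → F ∣ p - C ∣) ≡ F 0 + 2 * ∑ C (F ∘ suc)
  ∑-∣-C∣ F = begin
    ∑ N (λ p → F ∣ p - C ∣)
      ≡⟨ cong (λ m → ∑ m (λ p → F ∣ p - C ∣)) N≡C+sucC ⟩
    ∑ (C + suc C) (λ p → F ∣ p - C ∣)
      ≡⟨ ∑-split C (suc C) (λ p → F ∣ p - C ∣) ⟩
    ∑ C (λ p → F ∣ p - C ∣) + ∑ (suc C) (λ i → F ∣ C + i - C ∣)
      ≡⟨ cong₂ _+_ (trans (∑-reverse C (λ p → F ∣ p - C ∣)) (∑-cong C (λ i i<C → cong F (∣[c∸i]-c∣≡i C (suc i) i<C))))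
                   (∑-cong (suc C) (λ i _ → cong F (∣[c+i]-c∣≡i C i))) ⟩
    A + (F 0 + A)
      ≡⟨ solve 2 (λ a b → a :+ (b :+ a) := b :+ (con 2 :* a)) refl A (F 0) ⟩
    F 0 + 2 * A ∎
    where
      open ≡-Reasoning
      A = ∑ C (F ∘ suc)

  ∑-∣-C∣-next : ∀ (F : ℕ → ℕ) → F C ≡ 0 →
    ∑ N (λ p → F ∣ p - C ∣ * F ∣ next p - C ∣) ≡ 2 * ∑ C (λ i → F i * F (suc i))
  ∑-∣-C∣-next F FC≡0 = begin
    ∑ N G
      ≡⟨ cong (λ m → ∑ m G) N≡C+sucC ⟩
    ∑ (C + suc C) G
      ≡⟨ ∑-split C (suc C) G ⟩
    ∑ C G + ∑ (suc C) (λ i → G (C + i))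
      ≡⟨ cong (∑ C G +_) (∑-last C (λ i → G (C + i))) ⟩
    ∑ C G + (∑ C (λ i → G (C + i)) + G (C + C))
      ≡⟨ cong₂ (λ a b → a + (b + G (C + C))) (trans (∑-reverse C G) (∑-cong C left)) (∑-cong C right) ⟩
    A + (A + G (C + C))
      ≡⟨ cong (λ z → A + (A + z * F ∣ next (C + C) - C ∣)) (trans (cong F (∣[c+i]-c∣≡i C C)) FC≡0) ⟩
    A + (A + 0)
      ≡⟨ cong (A +_) (+-identityʳ A) ⟩
    A + A
      ≡⟨ cong (A +_) (sym (+-identityʳ A)) ⟩
    2 * A ∎
    where
      open ≡-Reasoning
      G : ℕ → ℕ
      G p = F ∣ p - C ∣ * F ∣ next p - C ∣
      A = ∑ C (λ i → F i * F (suc i))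
      left : ∀ i → i < C → G (C ∸ suc i) ≡ F i * F (suc i)
      left i i<C = begin
        F ∣ C ∸ suc i - C ∣ * F ∣ next (C ∸ suc i) - C ∣
          ≡⟨ cong₂ (λ a b → F a * F ∣ b - C ∣) (∣[c∸i]-c∣≡i C (suc i) i<C)
               (trans (next-< (C ∸ suc i) (≤-trans (s≤s (m∸n≤m C (suc i))) (m<m+n C (s≤s z≤n))))
                      (sym (+-∸-assoc 1 i<C))) ⟩
        F (suc i) * F ∣ C ∸ i - C ∣ ≡⟨ cong (λ z → F (suc i) * F z) (∣[c∸i]-c∣≡i C i (<⇒≤ i<C)) ⟩
        F (suc i) * F i             ≡⟨ *-comm (F (suc i)) (F i) ⟩
        F i * F (suc i)             ∎
      right : ∀ i → i < C → G (C + i) ≡ F i * F (suc i)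
      right i i<C = cong₂ (λ a b → F a * F b) (∣[c+i]-c∣≡i C i)
        (trans (cong (λ z → ∣ z - C ∣) (trans (next-< (C + i) (+-monoʳ-< C i<C)) (sym (+-suc C i))))
               (∣[c+i]-c∣≡i C (suc i)))

-- blockDist d s is the distance from v to the vertex (ℓ, b, a) of the block
-- (ℓ, b), when a is the slot of v, the layers of v and ℓ are at distance d,
-- and s says whether b is the block of v (otherwise a detour through a
-- neighbouring layer is needed).
blockDist : ℕ → Bool → ℕ
blockDist zero    true  = 0
blockDist zero    false = 2
blockDist (suc d) _     = suc d

blockDist-true : ∀ d → blockDist d true ≡ d
blockDist-true zero    = refl
blockDist-true (suc d) = refl

blockDist-step : ∀ d d' s s' → d' ≤ suc d → (d ≡ 0 → d' ≡ 0 → ⊥) → blockDist d' s' ≤ suc (blockDist d s)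
blockDist-step zero    zero          s     s'    _  notBoth = ⊥-elim (notBoth refl refl)
blockDist-step zero    (suc zero)    true  s'    _  _       = ≤-refl
blockDist-step zero    (suc zero)    false s'    _  _       = s≤s z≤n
blockDist-step zero    (suc (suc _)) s     s'    (s≤s ()) _
blockDist-step (suc d) zero          s     true  _  _       = z≤n
blockDist-step (suc d) zero          s     false _  _       = s≤s (s≤s z≤n)
blockDist-step (suc d) (suc d')      s     s'    le _       = le

∑-𝟙<ᵇ : ∀ n k c → k ≤ n → ∑ n (λ i → 𝟙 (i <ᵇ k) * c) ≡ k * c
∑-𝟙<ᵇ n       zero    c _ = ∑-zero n (λ i → 𝟙 (i <ᵇ 0) * c) (λ _ _ → refl)
∑-𝟙<ᵇ (suc n) (suc k) c (s≤s k≤n) = cong₂ _+_ (*-identityˡ c) (∑-𝟙<ᵇ n k c k≤n)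

-- The number of blocks (ℓ, b) with blockDist ≤ k on a layer at distance d,
-- for K blocks per layer.
module BlockCount (K : ℕ) where

  centreCount : ℕ → ℕ
  centreCount zero          = 1
  centreCount (suc zero)    = 1
  centreCount (suc (suc _)) = K

  blockCount : ℕ → ℕ → ℕ
  blockCount k zero    = centreCount k
  blockCount k (suc d) = 𝟙 (d <ᵇ k) * K

  adjacentCount : ℕ → ℕ → ℕ
  adjacentCount n k = ∑ n (λ i → blockCount k i * blockCount k (suc i))

  adjacentClosed : ℕ → ℕ
  adjacentClosed zero    = 0
  adjacentClosed (suc k) = centreCount (suc k) * K + k * (K * K)

  adjacentCount-closed : ∀ n k → k ≤ suc n → adjacentCount (suc n) k ≡ adjacentClosed k
  adjacentCount-closed n zero _ =
    ∑-zero n (λ i → blockCount 0 (suc i) * blockCount 0 (suc (suc i))) (λ _ _ → refl)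
  adjacentCount-closed n (suc k) (s≤s k≤n) =
    cong₂ _+_ (cong (centreCount (suc k) *_) (+-identityʳ K))
              (trans (∑-cong n (λ i _ → both i k)) (∑-𝟙<ᵇ n k (K * K) k≤n))
    where
      both : ∀ i k → (𝟙 (i <ᵇ suc k) * K) * (𝟙 (suc i <ᵇ suc k) * K) ≡ 𝟙 (i <ᵇ k) * (K * K)
      both zero    zero    = *-zeroʳ (K + 0 * K)
      both zero    (suc k) = trans (cong₂ _*_ (+-identityʳ K) (+-identityʳ K)) (sym (+-identityʳ (K * K)))
      both (suc i) zero    = refl
      both (suc i) (suc k) = both i k

module Construction (C₁ K M : ℕ) where

  open Cycle C₁ public
  open BlockCount K public

  n : ℕ
  n = N * K * M

  V : Set
  V = Fin n

  layerᶠ : V → Fin N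
  layerᶠ u = proj₁ (remQuot {N} K (proj₁ (remQuot {N * K} M u)))

  blockᶠ : V → Fin K
  blockᶠ u = proj₂ (remQuot {N} K (proj₁ (remQuot {N * K} M u)))

  slotᶠ : V → Fin M
  slotᶠ u = proj₂ (remQuot {N * K} M u)

  layer block slot : V → ℕ
  layer = toℕ ∘ layerᶠ
  block = toℕ ∘ blockᶠ
  slot  = toℕ ∘ slotᶠ

  vertex : Fin N → Fin K → Fin M → V
  vertex ℓ b a = combine (combine ℓ b) a

  layer-vertex : ∀ ℓ b a → layer (vertex ℓ b a) ≡ toℕ ℓ
  layer-vertex ℓ b a = cong toℕ (trans
    (cong (λ r → proj₁ (remQuot {N} K (proj₁ r))) (remQuot-combine {N * K} {M} (combine ℓ b) a))
    (cong proj₁ (remQuot-combine {N} {K} ℓ b)))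

  block-vertex : ∀ ℓ b a → block (vertex ℓ b a) ≡ toℕ b
  block-vertex ℓ b a = cong toℕ (trans
    (cong (λ r → proj₂ (remQuot {N} K (proj₁ r))) (remQuot-combine {N * K} {M} (combine ℓ b) a))
    (cong proj₂ (remQuot-combine {N} {K} ℓ b)))

  slot-vertex : ∀ ℓ b a → slot (vertex ℓ b a) ≡ toℕ a
  slot-vertex ℓ b a = cong (toℕ ∘ proj₂) (remQuot-combine {N * K} {M} (combine ℓ b) a)

  vertex-coordinates : ∀ u → vertex (layerᶠ u) (blockᶠ u) (slotᶠ u) ≡ u
  vertex-coordinates u =
    trans (cong (λ r → combine r (slotᶠ u)) (combine-remQuot {N} K (proj₁ (remQuot {N * K} M u))))
          (combine-remQuot {N * K} M u)

  on-vertex : ∀ {A : Set} (H : ℕ → ℕ → ℕ → A) ℓ b a →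
    H (layer (vertex ℓ b a)) (block (vertex ℓ b a)) (slot (vertex ℓ b a)) ≡ H (toℕ ℓ) (toℕ b) (toℕ a)
  on-vertex H ℓ b a = trans
    (cong₂ (λ x y → H x y (slot (vertex ℓ b a))) (layer-vertex ℓ b a) (block-vertex ℓ b a))
    (cong (H (toℕ ℓ) (toℕ b)) (slot-vertex ℓ b a))

  coordinates-injective : ∀ u w → layer u ≡ layer w → block u ≡ block w → slot u ≡ slot w → u ≡ w
  coordinates-injective u w eℓ eb ea = begin
    u                                       ≡⟨ sym (vertex-coordinates u) ⟩
    vertex (layerᶠ u) (blockᶠ u) (slotᶠ u)  ≡⟨ cong₂ (λ ℓ b → vertex ℓ b (slotᶠ u)) (toℕ-injective eℓ) (toℕ-injective eb) ⟩
    vertex (layerᶠ w) (blockᶠ w) (slotᶠ u)  ≡⟨ cong (vertex (layerᶠ w) (blockᶠ w)) (toℕ-injective ea) ⟩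
    vertex (layerᶠ w) (blockᶠ w) (slotᶠ w)  ≡⟨ vertex-coordinates w ⟩
    w                                       ∎
    where open ≡-Reasoning

  layer<N : ∀ u → layer u < N
  layer<N u = toℕ<n (layerᶠ u)

  blue red adjacent : V → V → Bool
  blue u w = (layer u ≡ᵇ layer w) ∧ ((block u ≡ᵇ block w) ∧ not (slot u ≡ᵇ slot w))
  red  u w = adjLayer (layer u) (layer w) ∧ (slot u ≡ᵇ slot w)
  adjacent u w = blue u w ∨ red u w

  blue-sym : ∀ u w → blue u w ≡ blue w u
  blue-sym u w rewrite ≡ᵇ-sym (layer u) (layer w) | ≡ᵇ-sym (block u) (block w) | ≡ᵇ-sym (slot u) (slot w) = refl

  red-sym : ∀ u w → red u w ≡ red w u
  red-sym u w rewrite adjLayer-sym (layer u) (layer w) (layer<N u) (layer<N w) | ≡ᵇ-sym (slot u) (slot w) = refl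

  adjacent-sym : ∀ u w → adjacent u w ≡ adjacent w u
  adjacent-sym u w = cong₂ _∨_ (blue-sym u w) (red-sym u w)

  adjacent-irrefl : ∀ u → adjacent u u ≡ false
  adjacent-irrefl u
    rewrite ≡ᵇ-refl (layer u) | ≡ᵇ-refl (block u) | ≡ᵇ-refl (slot u) | adjLayer-irrefl (layer u) (layer<N u) = refl

  graph : Graph n
  graph = record { adj = adjacent ; sym = adjacent-sym ; irrefl = adjacent-irrefl }

  colour : V → V → Colour
  colour u w = if layer u ≡ᵇ layer w then c1 else c2

  colouring : EdgeColouring graph
  colouring = record
    { col    = colour
    ; colSym = λ u w _ → cong (λ b → if b then c1 else c2) (≡ᵇ-sym (layer u) (layer w)) }

  -- The graph distance from v to the vertex with coordinates (ℓ, b, a).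
  distTo : V → ℕ → ℕ → ℕ → ℕ
  distTo v ℓ b a = 𝟙 (not (slot v ≡ᵇ a)) + blockDist (layerDist (layer v) ℓ) (block v ≡ᵇ b)

  dist : V → V → ℕ
  dist v u = distTo v (layer u) (block u) (slot u)

  blockDistance : V → V → ℕ
  blockDistance v u = blockDist (layerDist (layer v) (layer u)) (block v ≡ᵇ block u)

  dist-self : ∀ v → dist v v ≡ 0
  dist-self v rewrite ≡ᵇ-refl (slot v) | ≡ᵇ-refl (block v) | layerDist-self (layer v) (layer<N v) = refl

  dist≡0⇒≡ : ∀ v u → dist v u ≡ 0 → u ≡ v
  dist≡0⇒≡ v u eq with slot v ≡ᵇ slot u in ea | layerDist (layer v) (layer u) in eℓ | block v ≡ᵇ block u in eb
  ... | true | zero | true =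
    coordinates-injective u v (layerDist≡0⇒≡ (layer v) (layer u) (layer<N v) (layer<N u) eℓ)
                              (sym (≡ᵇ-true eb)) (sym (≡ᵇ-true ea))
  ... | true  | zero  | false = ⊥-elim (0≢1+n (sym eq))
  ... | true  | suc _ | _     = ⊥-elim (0≢1+n (sym eq))
  ... | false | _     | _     = ⊥-elim (0≢1+n (sym eq))

  dist-adjacent : ∀ v w u → T (adjacent w u) → dist v u ≤ suc (dist v w)
  dist-adjacent v w u t with T-∨-elim {blue w u} t
  ... | inj₁ t-blue = begin
    𝟙 (not (slot v ≡ᵇ slot u)) + ρ u  ≤⟨ +-monoˡ-≤ (ρ u) (𝟙≤1 _) ⟩
    suc (ρ u)                         ≡⟨ cong suc sameBlock ⟩
    suc (ρ w)                         ≤⟨ s≤s (m≤n+m (ρ w) _) ⟩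
    suc (dist v w)                    ∎
    where
      open ≤-Reasoning
      ρ = blockDistance v
      parts = T-∧-elim {layer w ≡ᵇ layer u} t-blue
      sameBlock : ρ u ≡ ρ w
      sameBlock = cong₂ (λ ℓ b → blockDist (layerDist (layer v) ℓ) (block v ≡ᵇ b))
        (sym (≡ᵇ⇒≡ (layer w) (layer u) (proj₁ parts)))
        (sym (≡ᵇ⇒≡ (block w) (block u) (proj₁ (T-∧-elim {block w ≡ᵇ block u} (proj₂ parts)))))
  ... | inj₂ t-red = begin
    𝟙 (not (slot v ≡ᵇ slot u)) + ρ u
      ≡⟨ cong (λ a → 𝟙 (not (slot v ≡ᵇ a)) + ρ u) (sym (≡ᵇ⇒≡ (slot w) (slot u) sameSlot)) ⟩
    𝟙 (not (slot v ≡ᵇ slot w)) + ρ u  ≤⟨ +-monoʳ-≤ (𝟙 (not (slot v ≡ᵇ slot w))) step ⟩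
    𝟙 (not (slot v ≡ᵇ slot w)) + suc (ρ w) ≡⟨ +-suc _ _ ⟩
    suc (dist v w)                    ∎
    where
      open ≤-Reasoning
      ρ = blockDistance v
      adjLayers = proj₁ (T-∧-elim t-red)
      sameSlot = proj₂ (T-∧-elim {adjLayer (layer w) (layer u)} t-red)
      notBothAtV : layerDist (layer v) (layer w) ≡ 0 → layerDist (layer v) (layer u) ≡ 0 → ⊥
      notBothAtV dw du = subst T
        (trans (cong₂ adjLayer (layerDist≡0⇒≡ (layer v) (layer w) (layer<N v) (layer<N w) dw)
                               (layerDist≡0⇒≡ (layer v) (layer u) (layer<N v) (layer<N u) du))
               (adjLayer-irrefl (layer v) (layer<N v)))
        adjLayers
      step : ρ u ≤ suc (ρ w)
      step = blockDist-step _ _ _ _ (layerDist-adj (layer v) (layer w) (layer u) adjLayers) notBothAtV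

  blueNeighbour : ∀ v u → T (not (slot v ≡ᵇ slot u)) →
    let w = vertex (layerᶠ u) (blockᶠ u) (slotᶠ v) in
    T (adjacent w u) × dist v w ≡ blockDistance v u
  blueNeighbour v u otherSlot = T-∨-introˡ isBlue , distance
    where
      isBlue : T (blue (vertex (layerᶠ u) (blockᶠ u) (slotᶠ v)) u)
      isBlue rewrite layer-vertex (layerᶠ u) (blockᶠ u) (slotᶠ v) | block-vertex (layerᶠ u) (blockᶠ u) (slotᶠ v)
                   | slot-vertex (layerᶠ u) (blockᶠ u) (slotᶠ v) | ≡ᵇ-refl (layer u) | ≡ᵇ-refl (block u) = otherSlot
      distance : dist v (vertex (layerᶠ u) (blockᶠ u) (slotᶠ v)) ≡ blockDistance v u
      distance = begin
        dist v (vertex (layerᶠ u) (blockᶠ u) (slotᶠ v))  ≡⟨ on-vertex (distTo v) (layerᶠ u) (blockᶠ u) (slotᶠ v) ⟩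
        distTo v (layer u) (block u) (slot v)            ≡⟨ cong (λ s → 𝟙 (not s) + blockDistance v u) (≡ᵇ-refl (slot v)) ⟩
        blockDistance v u                                ∎
        where open ≡-Reasoning

  redNeighbour : ∀ v u x (x<N : x < N) → T (adjLayer x (layer u)) → T (slot v ≡ᵇ slot u) →
    let w = vertex (fromℕ< x<N) (blockᶠ v) (slotᶠ u) in
    T (adjacent w u) × dist v w ≡ layerDist (layer v) x
  redNeighbour v u x x<N adj sameSlot = T-∨-introʳ {blue w u} isRed , distance
    where
      w = vertex (fromℕ< x<N) (blockᶠ v) (slotᶠ u)
      isRed : T (red w u)
      isRed rewrite layer-vertex (fromℕ< x<N) (blockᶠ v) (slotᶠ u) | toℕ-fromℕ< x<N
                  | slot-vertex (fromℕ< x<N) (blockᶠ v) (slotᶠ u) | ≡ᵇ-refl (slot u) = T-∧-intro adj _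
      distance : dist v w ≡ layerDist (layer v) x
      distance = begin
        dist v w
          ≡⟨ on-vertex (distTo v) (fromℕ< x<N) (blockᶠ v) (slotᶠ u) ⟩
        distTo v (toℕ (fromℕ< x<N)) (block v) (slot u)
          ≡⟨ cong (λ ℓ → distTo v ℓ (block v) (slot u)) (toℕ-fromℕ< x<N) ⟩
        distTo v x (block v) (slot u)
          ≡⟨ cong₂ (λ s t → 𝟙 (not s) + blockDist (layerDist (layer v) x) t) (T⇒≡true sameSlot) (≡ᵇ-refl (block v)) ⟩
        blockDist (layerDist (layer v) x) true
          ≡⟨ blockDist-true _ ⟩
        layerDist (layer v) x ∎
        where open ≡-Reasoning

  dist-closer : ∀ v u d → dist v u ≡ suc d → Σ V (λ w → T (adjacent w u) × dist v w ≡ d)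
  dist-closer v u d eq with slot v ≡ᵇ slot u in ea
  ... | false = vertex (layerᶠ u) (blockᶠ u) (slotᶠ v) , proj₁ b , trans (proj₂ b) (suc-injective eq)
    where b = blueNeighbour v u (subst (T ∘ not) (sym ea) _)
  ... | true with layerDist (layer v) (layer u) in eℓ | block v ≡ᵇ block u
  ...   | zero | true  = ⊥-elim (0≢1+n eq)
  ...   | zero | false =
    vertex (fromℕ< (next<N (layer v))) (blockᶠ v) (slotᶠ u) , proj₁ r ,
    trans (proj₂ r) (trans (layerDist-next-self (layer v) (layer<N v)) (suc-injective eq))
    where
      sameLayer : layer u ≡ layer v
      sameLayer = layerDist≡0⇒≡ (layer v) (layer u) (layer<N v) (layer<N u) eℓ
      adj : T (adjLayer (next (layer v)) (layer u))
      adj = subst (T ∘ adjLayer (next (layer v))) (sym sameLayer)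
              (adjLayer-symmetric (layer v) (next (layer v)) (layer<N v) (next<N (layer v))
                                  (adjLayer-next (layer v)))
      r = redNeighbour v u (next (layer v)) (next<N (layer v)) adj (≡true⇒T ea)
  ...   | suc d' | _ with layerDist-closer (layer v) (layer u) d' (layer<N u) eℓ
  ...     | x , x<N , adj , dx =
    vertex (fromℕ< x<N) (blockᶠ v) (slotᶠ u) , proj₁ r , trans (proj₂ r) (trans dx (suc-injective eq))
    where r = redNeighbour v u x x<N adj (≡true⇒T ea)

  inBall≡dist≤ᵇ : ∀ j v u → inBall graph j v u ≡ (dist v u ≤ᵇ j)
  inBall≡dist≤ᵇ zero v u = T-injective toDist fromDist
    where
      toDist : T (toℕ v ≡ᵇ toℕ u) → T (dist v u ≤ᵇ 0)
      toDist t = subst (λ x → T (dist v x ≤ᵇ 0)) (toℕ-injective (≡ᵇ⇒≡ (toℕ v) (toℕ u) t))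
                       (subst (λ d → T (d ≤ᵇ 0)) (sym (dist-self v)) _)
      fromDist : T (dist v u ≤ᵇ 0) → T (toℕ v ≡ᵇ toℕ u)
      fromDist t = subst (λ x → T (toℕ v ≡ᵇ toℕ x)) (sym (dist≡0⇒≡ v u (n≤0⇒n≡0 (≤ᵇ⇒≤ (dist v u) 0 t))))
                         (≡⇒≡ᵇ (toℕ v) (toℕ v) refl)
  inBall≡dist≤ᵇ (suc j) v u =
    trans (cong₂ _∨_ (inBall≡dist≤ᵇ j v u)
                     (cong or (map-cong (λ w → cong (_∧ adjacent w u) (inBall≡dist≤ᵇ j v w)) (allFin n))))
          (T-injective toDist fromDist)
    where
      viaNeighbour : V → Bool
      viaNeighbour w = (dist v w ≤ᵇ j) ∧ adjacent w u
      toDist : T ((dist v u ≤ᵇ j) ∨ or (map viaNeighbour (allFin n))) → T (dist v u ≤ᵇ suc j)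
      toDist t with T-∨-elim {dist v u ≤ᵇ j} t
      ... | inj₁ near = ≤⇒≤ᵇ (m≤n⇒m≤1+n (≤ᵇ⇒≤ (dist v u) j near))
      ... | inj₂ far with or-map-tabulate-elim viaNeighbour (λ x → x) far
      ...   | w , tw = ≤⇒≤ᵇ (≤-trans (dist-adjacent v w u (proj₂ parts)) (s≤s (≤ᵇ⇒≤ (dist v w) j (proj₁ parts))))
        where parts = T-∧-elim {dist v w ≤ᵇ j} tw
      fromDist : T (dist v u ≤ᵇ suc j) → T ((dist v u ≤ᵇ j) ∨ or (map viaNeighbour (allFin n)))
      fromDist t with m≤n⇒m<n∨m≡n (≤ᵇ⇒≤ (dist v u) (suc j) t)
      ... | inj₁ lt = T-∨-introˡ (≤⇒≤ᵇ (≤-pred lt))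
      ... | inj₂ eq with dist-closer v u j eq
      ...   | w , adj , dw = T-∨-introʳ {dist v u ≤ᵇ j}
                (or-map-tabulate-intro viaNeighbour (λ x → x) w
                  (T-∧-intro {dist v w ≤ᵇ j} (≤⇒≤ᵇ (≤-reflexive dw)) adj))

  ∑ᶜ : (ℕ → ℕ → ℕ → ℕ) → ℕ
  ∑ᶜ H = ∑ N (λ ℓ → ∑ K (λ b → ∑ M (H ℓ b)))

  ∑ᶠ-coordinates : ∀ (H : ℕ → ℕ → ℕ → ℕ) → ∑ᶠ {n} (λ u → H (layer u) (block u) (slot u)) ≡ ∑ᶜ H
  ∑ᶠ-coordinates H = begin
    ∑ᶠ {n} F
      ≡⟨ ∑ᶠ-combine (N * K) M F ⟩
    ∑ᶠ {N * K} (λ r → ∑ᶠ {M} (λ a → F (combine r a)))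
      ≡⟨ ∑ᶠ-combine N K (λ r → ∑ᶠ {M} (λ a → F (combine r a))) ⟩
    ∑ᶠ {N} (λ ℓ → ∑ᶠ {K} (λ b → ∑ᶠ {M} (λ a → F (vertex ℓ b a))))
      ≡⟨ ∑ᶠ-cong {N} (λ ℓ → ∑ᶠ-cong {K} (λ b → ∑ᶠ-cong {M} (on-vertex H ℓ b))) ⟩
    ∑ᶠ {N} (λ ℓ → ∑ᶠ {K} (λ b → ∑ᶠ {M} (H (toℕ ℓ) (toℕ b) ∘ toℕ)))
      ≡⟨ ∑ᶠ-cong {N} (λ ℓ → ∑ᶠ-cong {K} (λ b → ∑ᶠ-toℕ M (H (toℕ ℓ) (toℕ b)))) ⟩
    ∑ᶠ {N} (λ ℓ → ∑ᶠ {K} (λ b → ∑ M (H (toℕ ℓ) (toℕ b))))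
      ≡⟨ ∑ᶠ-cong {N} (λ ℓ → ∑ᶠ-toℕ K (λ b → ∑ M (H (toℕ ℓ) b))) ⟩
    ∑ᶠ {N} (λ ℓ → ∑ K (λ b → ∑ M (H (toℕ ℓ) b)))
      ≡⟨ ∑ᶠ-toℕ N (λ ℓ → ∑ K (λ b → ∑ M (H ℓ b))) ⟩
    ∑ᶜ H ∎
    where
      open ≡-Reasoning
      F : V → ℕ
      F u = H (layer u) (block u) (slot u)

  ∑ᶠ²-coordinates : ∀ (H : ℕ → ℕ → ℕ → ℕ → ℕ → ℕ → ℕ) →
    ∑ᶠ {n} (λ x → ∑ᶠ {n} (λ y → H (layer x) (block x) (slot x) (layer y) (block y) (slot y)))
      ≡ ∑ᶜ (λ ℓ b a → ∑ᶜ (H ℓ b a))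
  ∑ᶠ²-coordinates H =
    trans (∑ᶠ-coordinates (λ ℓ b a → ∑ᶠ {n} (λ y → H ℓ b a (layer y) (block y) (slot y))))
          (∑-cong N (λ ℓ _ → ∑-cong K (λ b _ → ∑-cong M (λ a _ → ∑ᶠ-coordinates (H ℓ b a)))))

  red-sameLayer : ∀ u w → T (layer u ≡ᵇ layer w) → red u w ≡ false
  red-sameLayer u w t = cong (_∧ (slot u ≡ᵇ slot w)) (begin
    adjLayer (layer u) (layer w)  ≡⟨ cong (adjLayer (layer u)) (sym (≡ᵇ⇒≡ (layer u) (layer w) t)) ⟩
    adjLayer (layer u) (layer u)  ≡⟨ adjLayer-irrefl (layer u) (layer<N u) ⟩
    false                         ∎)
    where open ≡-Reasoning

  adjacent-c1 : ∀ u w → (adjacent u w ∧ (colour u w ==ᶜ c1)) ≡ blue u w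
  adjacent-c1 u w with layer u ≡ᵇ layer w in eq
  ... | true  rewrite red-sameLayer u w (≡true⇒T eq) = trans (∧-identityʳ _) (∨-identityʳ _)
  ... | false = ∧-zeroʳ (red u w)

  adjacent-c2 : ∀ u w → (adjacent u w ∧ (colour u w ==ᶜ c2)) ≡ red u w
  adjacent-c2 u w with layer u ≡ᵇ layer w in eq
  ... | true  rewrite red-sameLayer u w (≡true⇒T eq) = ∧-zeroʳ _
  ... | false = ∧-identityʳ (red u w)

  degree-∑ᶠ : ∀ c v → degree graph colouring c v ≡ ∑ᶠ {n} (λ u → 𝟙 (adjacent v u ∧ (colour v u ==ᶜ c)))
  degree-∑ᶠ c v = length-filterᵇ-tabulate (λ u → adjacent v u ∧ (colour v u ==ᶜ c)) (λ u → u)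

  edgeInBall : Colour → ℕ → V → V → V → Bool
  edgeInBall c j v x y = adjacent x y ∧ (colour x y ==ᶜ c) ∧ inBall graph j v x ∧ inBall graph j v y

  2e≡∑ᶠ∑ᶠ : ∀ c j v → 2 * e graph colouring c j v ≡ ∑ᶠ {n} (λ x → ∑ᶠ {n} (λ y → 𝟙 (edgeInBall c j v x y)))
  2e≡∑ᶠ∑ᶠ c j v = double-counting graph colouring _ symmetric irreflexive
    where
      symmetric : ∀ x y → edgeInBall c j v x y ≡ edgeInBall c j v y x
      symmetric x y
        rewrite adjacent-sym x y | ≡ᵇ-sym (layer x) (layer y) | ∧-comm (inBall graph j v x) (inBall graph j v y)
        = refl
      irreflexive : ∀ x → edgeInBall c j v x x ≡ false
      irreflexive x rewrite adjacent-irrefl x = refl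

  edgeInBall-c1 : ∀ j v x y → edgeInBall c1 j v x y ≡ (blue x y ∧ ((dist v x ≤ᵇ j) ∧ (dist v y ≤ᵇ j)))
  edgeInBall-c1 j v x y = trans (sym (∧-assoc (adjacent x y) (colour x y ==ᶜ c1) _))
    (cong₂ _∧_ (adjacent-c1 x y) (cong₂ _∧_ (inBall≡dist≤ᵇ j v x) (inBall≡dist≤ᵇ j v y)))

  edgeInBall-c2 : ∀ j v x y → edgeInBall c2 j v x y ≡ (red x y ∧ ((dist v x ≤ᵇ j) ∧ (dist v y ≤ᵇ j)))
  edgeInBall-c2 j v x y = trans (sym (∧-assoc (adjacent x y) (colour x y ==ᶜ c2) _))
    (cong₂ _∧_ (adjacent-c2 x y) (cong₂ _∧_ (inBall≡dist≤ᵇ j v x) (inBall≡dist≤ᵇ j v y)))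

  degree-c1 : ∀ v → degree graph colouring c1 v ≡ M ∸ 1
  degree-c1 v = begin
    degree graph colouring c1 v
      ≡⟨ degree-∑ᶠ c1 v ⟩
    ∑ᶠ {n} (λ u → 𝟙 (adjacent v u ∧ (colour v u ==ᶜ c1)))
      ≡⟨ ∑ᶠ-cong (λ u → cong 𝟙 (adjacent-c1 v u)) ⟩
    ∑ᶠ {n} (λ u → 𝟙 (blue v u))
      ≡⟨ ∑ᶠ-coordinates (λ ℓ b a → 𝟙 ((layer v ≡ᵇ ℓ) ∧ clique b a)) ⟩
    ∑ N (λ ℓ → ∑ K (λ b → ∑ M (λ a → 𝟙 ((layer v ≡ᵇ ℓ) ∧ clique b a))))
      ≡⟨ ∑-at N (layer v) (λ _ s → ∑ K (λ b → ∑ M (λ a → 𝟙 (s ∧ clique b a)))) (layer<N v)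
              (λ _ → ∑-zero K _ (λ _ _ → ∑-zero M _ (λ _ _ → refl))) ⟩
    ∑ K (λ b → ∑ M (λ a → 𝟙 ((block v ≡ᵇ b) ∧ not (slot v ≡ᵇ a))))
      ≡⟨ ∑-at K (block v) (λ _ s → ∑ M (λ a → 𝟙 (s ∧ not (slot v ≡ᵇ a)))) (toℕ<n (blockᶠ v))
              (λ _ → ∑-zero M _ (λ _ _ → refl)) ⟩
    ∑ M (λ a → 𝟙 (not (slot v ≡ᵇ a)))
      ≡⟨ ∑-≡ᵇ M (slot v) (𝟙 ∘ not) (toℕ<n (slotᶠ v)) ⟩
    (M ∸ 1) * 1
      ≡⟨ *-identityʳ (M ∸ 1) ⟩
    M ∸ 1 ∎
    where
      open ≡-Reasoning
      clique : ℕ → ℕ → Bool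
      clique b a = (block v ≡ᵇ b) ∧ not (slot v ≡ᵇ a)

  degree-c2 : ∀ v → degree graph colouring c2 v ≡ 2 * K
  degree-c2 v = begin
    degree graph colouring c2 v
      ≡⟨ degree-∑ᶠ c2 v ⟩
    ∑ᶠ {n} (λ u → 𝟙 (adjacent v u ∧ (colour v u ==ᶜ c2)))
      ≡⟨ ∑ᶠ-cong (λ u → cong 𝟙 (adjacent-c2 v u)) ⟩
    ∑ᶠ {n} (λ u → 𝟙 (red v u))
      ≡⟨ ∑ᶠ-coordinates (λ ℓ b a → 𝟙 (adjLayer (layer v) ℓ ∧ (slot v ≡ᵇ a))) ⟩
    ∑ N (λ ℓ → ∑ K (λ b → ∑ M (λ a → 𝟙 (adjLayer (layer v) ℓ ∧ (slot v ≡ᵇ a)))))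
      ≡⟨ ∑-cong N (λ ℓ _ → ∑-cong K (λ b _ →
           ∑-at M (slot v) (λ _ s → 𝟙 (adjLayer (layer v) ℓ ∧ s)) (toℕ<n (slotᶠ v)) (λ _ → cong 𝟙 (∧-zeroʳ _)))) ⟩
    ∑ N (λ ℓ → ∑ K (λ b → 𝟙 (adjLayer (layer v) ℓ ∧ true)))
      ≡⟨ ∑-cong N (λ ℓ _ → trans (∑-const K _) (cong (λ s → K * 𝟙 s) (∧-identityʳ (adjLayer (layer v) ℓ)))) ⟩
    ∑ N (λ ℓ → K * 𝟙 (adjLayer (layer v) ℓ))
      ≡⟨ ∑-*ˡ N K (λ ℓ → 𝟙 (adjLayer (layer v) ℓ)) ⟩
    K * ∑ N (λ ℓ → 𝟙 (adjLayer (layer v) ℓ))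
      ≡⟨ cong (K *_) (∑-𝟙-adjLayer (layer v) (layer<N v)) ⟩
    K * 2
      ≡⟨ *-comm K 2 ⟩
    2 * K ∎
    where open ≡-Reasoning

  module AroundVertex (v : V) where

    ρ : ℕ → ℕ → ℕ
    ρ ℓ b = blockDist (layerDist (layer v) ℓ) (block v ≡ᵇ b)

    within : ℕ → ℕ → ℕ → ℕ → Bool
    within j ℓ b a = distTo v ℓ b a ≤ᵇ j

    1≤K : 1 ≤ K
    1≤K = ≤-trans (s≤s z≤n) (toℕ<n (blockᶠ v))

    c+[K∸1]*c≡c*K : ∀ c → c + (K ∸ 1) * c ≡ c * K
    c+[K∸1]*c≡c*K c = begin
      c + (K ∸ 1) * c   ≡⟨ cong (c +_) (*-comm (K ∸ 1) c) ⟩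
      c + c * (K ∸ 1)   ≡⟨ sym (*-suc c (K ∸ 1)) ⟩
      c * suc (K ∸ 1)   ≡⟨ cong (c *_) (m+[n∸m]≡n 1≤K) ⟩
      c * K             ∎
      where open ≡-Reasoning

    ∑-blocks : ∀ d k → ∑ K (λ b → 𝟙 (blockDist d (block v ≡ᵇ b) ≤ᵇ k)) ≡ blockCount k d
    ∑-blocks d k = trans (∑-≡ᵇ K (block v) (λ s → 𝟙 (blockDist d s ≤ᵇ k)) (toℕ<n (blockᶠ v))) (closedForm d k)
      where
        closedForm : ∀ d k → 𝟙 (blockDist d true ≤ᵇ k) + (K ∸ 1) * 𝟙 (blockDist d false ≤ᵇ k) ≡ blockCount k d
        closedForm (suc d) k             = c+[K∸1]*c≡c*K (𝟙 (suc d ≤ᵇ k))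
        closedForm zero    zero          = cong suc (*-zeroʳ (K ∸ 1))
        closedForm zero    (suc zero)    = cong suc (*-zeroʳ (K ∸ 1))
        closedForm zero    (suc (suc k)) = trans (cong suc (*-identityʳ (K ∸ 1))) (m+[n∸m]≡n 1≤K)

    ∑-layers-blocks : ∀ k → k ≤ C → ∑ N (λ ℓ → ∑ K (λ b → 𝟙 (ρ ℓ b ≤ᵇ k))) ≡ centreCount k + 2 * (k * K)
    ∑-layers-blocks k k≤C = begin
      ∑ N (λ ℓ → ∑ K (λ b → 𝟙 (ρ ℓ b ≤ᵇ k)))
        ≡⟨ ∑-cong N (λ ℓ _ → ∑-blocks (layerDist (layer v) ℓ) k) ⟩
      ∑ N ((λ p → blockCount k ∣ p - C ∣) ∘ recentre (layer v))
        ≡⟨ ∑-recentre (layer v) (λ p → blockCount k ∣ p - C ∣) ⟩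
      ∑ N (λ p → blockCount k ∣ p - C ∣)
        ≡⟨ ∑-∣-C∣ (blockCount k) ⟩
      centreCount k + 2 * ∑ C (λ i → 𝟙 (i <ᵇ k) * K)
        ≡⟨ cong (λ z → centreCount k + 2 * z) (∑-𝟙<ᵇ C k K k≤C) ⟩
      centreCount k + 2 * (k * K) ∎
      where open ≡-Reasoning

    -- A clique edge {a, a'} of block (ℓ, b) lies in the ball of radius j iff
    -- ρ ℓ b < j, because one of a, a' differs from the slot of v.
    ∑-clique-pairs : ∀ ℓ b j →
      ∑ M (λ a → ∑ M (λ a' → 𝟙 (not (a ≡ᵇ a') ∧ (within j ℓ b a ∧ within j ℓ b a'))))
        ≡ 𝟙 (suc (ρ ℓ b) ≤ᵇ j) * (M * (M ∸ 1))
    ∑-clique-pairs ℓ b j with suc (ρ ℓ b) ≤ᵇ j in eq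
    ... | true = begin
      ∑ M (λ a → ∑ M (λ a' → 𝟙 (not (a ≡ᵇ a') ∧ (within j ℓ b a ∧ within j ℓ b a'))))
        ≡⟨ ∑-cong M (λ a _ → ∑-cong M (λ a' _ → cong 𝟙 (both a a'))) ⟩
      ∑ M (λ a → ∑ M (λ a' → 𝟙 (not (a ≡ᵇ a'))))
        ≡⟨ ∑-cong M (λ a a<M → trans (∑-≡ᵇ M a (𝟙 ∘ not) a<M) (*-identityʳ (M ∸ 1))) ⟩
      ∑ M (λ _ → M ∸ 1)
        ≡⟨ ∑-const M (M ∸ 1) ⟩
      M * (M ∸ 1)
        ≡⟨ sym (+-identityʳ _) ⟩
      1 * (M * (M ∸ 1)) ∎
      where
        open ≡-Reasoning
        inside : ∀ a → within j ℓ b a ≡ true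
        inside a = T⇒≡true (≤⇒≤ᵇ (≤-trans (+-monoˡ-≤ (ρ ℓ b) (𝟙≤1 (not (slot v ≡ᵇ a))))
                                          (≤ᵇ⇒≤ (suc (ρ ℓ b)) j (≡true⇒T eq))))
        both : ∀ a a' → (not (a ≡ᵇ a') ∧ (within j ℓ b a ∧ within j ℓ b a')) ≡ not (a ≡ᵇ a')
        both a a' rewrite inside a | inside a' = ∧-identityʳ _
    ... | false = ∑-zero M _ (λ a _ → ∑-zero M _ (λ a' _ → outside a a'))
      where
        outside : ∀ a a' → 𝟙 (not (a ≡ᵇ a') ∧ (within j ℓ b a ∧ within j ℓ b a')) ≡ 0
        outside a a' with slot v ≡ᵇ a in e₁ | slot v ≡ᵇ a' in e₂
        ... | false | _     rewrite eq = cong 𝟙 (∧-zeroʳ _)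
        ... | true  | false rewrite eq = cong 𝟙 (trans (cong (not (a ≡ᵇ a') ∧_) (∧-zeroʳ _)) (∧-zeroʳ _))
        ... | true  | true
          rewrite T⇒≡true (≡⇒≡ᵇ a a' (trans (sym (≡ᵇ-true {slot v} e₁)) (≡ᵇ-true {slot v} e₂))) = refl

    2e-c1 : ∀ j → j ≤ C → 2 * e graph colouring c1 (suc j) v ≡ M * (M ∸ 1) * (centreCount j + 2 * (j * K))
    2e-c1 j j≤C = begin
      2 * e graph colouring c1 (suc j) v
        ≡⟨ 2e≡∑ᶠ∑ᶠ c1 (suc j) v ⟩
      ∑ᶠ {n} (λ x → ∑ᶠ {n} (λ y → 𝟙 (edgeInBall c1 (suc j) v x y)))
        ≡⟨ ∑ᶠ-cong {n} (λ x → ∑ᶠ-cong {n} (λ y → cong 𝟙 (edgeInBall-c1 (suc j) v x y))) ⟩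
      ∑ᶠ {n} (λ x → ∑ᶠ {n} (λ y → 𝟙 (blue x y ∧ ((dist v x ≤ᵇ suc j) ∧ (dist v y ≤ᵇ suc j)))))
        ≡⟨ ∑ᶠ²-coordinates (λ ℓ b a ℓ' b' a' →
             𝟙 (((ℓ ≡ᵇ ℓ') ∧ ((b ≡ᵇ b') ∧ not (a ≡ᵇ a'))) ∧ inside ℓ b a ℓ' b' a')) ⟩
      ∑ᶜ (λ ℓ b a → ∑ᶜ (λ ℓ' b' a' → 𝟙 (((ℓ ≡ᵇ ℓ') ∧ ((b ≡ᵇ b') ∧ not (a ≡ᵇ a'))) ∧ inside ℓ b a ℓ' b' a')))
        ≡⟨ ∑-cong N (λ ℓ ℓ<N → ∑-cong K (λ b b<K → ∑-cong M (λ a _ → sameBlock ℓ b a ℓ<N b<K))) ⟩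
      ∑ N (λ ℓ → ∑ K (λ b → ∑ M (λ a → ∑ M (λ a' → 𝟙 (not (a ≡ᵇ a') ∧ inside ℓ b a ℓ b a')))))
        ≡⟨ ∑-cong N (λ ℓ _ → ∑-cong K (λ b _ →
             trans (∑-clique-pairs ℓ b (suc j)) (cong (λ s → 𝟙 s * MM) (suc≤ᵇsuc (ρ ℓ b) j)))) ⟩
      ∑ N (λ ℓ → ∑ K (λ b → 𝟙 (ρ ℓ b ≤ᵇ j) * MM))
        ≡⟨ trans (∑-cong N (λ ℓ _ → ∑-*ʳ K MM (λ b → 𝟙 (ρ ℓ b ≤ᵇ j))))
                 (∑-*ʳ N MM (λ ℓ → ∑ K (λ b → 𝟙 (ρ ℓ b ≤ᵇ j)))) ⟩
      ∑ N (λ ℓ → ∑ K (λ b → 𝟙 (ρ ℓ b ≤ᵇ j))) * MM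
        ≡⟨ cong (_* MM) (∑-layers-blocks j j≤C) ⟩
      (centreCount j + 2 * (j * K)) * MM
        ≡⟨ *-comm _ MM ⟩
      MM * (centreCount j + 2 * (j * K)) ∎
      where
        open ≡-Reasoning
        MM = M * (M ∸ 1)
        inside : ℕ → ℕ → ℕ → ℕ → ℕ → ℕ → Bool
        inside ℓ b a ℓ' b' a' = within (suc j) ℓ b a ∧ within (suc j) ℓ' b' a'
        sameBlock : ∀ ℓ b a → ℓ < N → b < K →
          ∑ᶜ (λ ℓ' b' a' → 𝟙 (((ℓ ≡ᵇ ℓ') ∧ ((b ≡ᵇ b') ∧ not (a ≡ᵇ a'))) ∧ inside ℓ b a ℓ' b' a'))
            ≡ ∑ M (λ a' → 𝟙 (not (a ≡ᵇ a') ∧ inside ℓ b a ℓ b a'))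
        sameBlock ℓ b a ℓ<N b<K = trans
          (∑-at N ℓ (λ ℓ' s → ∑ K (λ b' → ∑ M (λ a' → 𝟙 ((s ∧ ((b ≡ᵇ b') ∧ not (a ≡ᵇ a'))) ∧ inside ℓ b a ℓ' b' a'))))
            ℓ<N (λ _ → ∑-zero K _ (λ _ _ → ∑-zero M _ (λ _ _ → refl))))
          (∑-at K b (λ b' s → ∑ M (λ a' → 𝟙 ((s ∧ not (a ≡ᵇ a')) ∧ inside ℓ b a ℓ b' a')))
            b<K (λ _ → ∑-zero M _ (λ _ _ → refl)))

    threshold : ℕ → Bool → ℕ
    threshold j true  = suc j
    threshold j false = j

    within-suc : ∀ j ℓ b a → within (suc j) ℓ b a ≡ (ρ ℓ b ≤ᵇ threshold j (slot v ≡ᵇ a))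
    within-suc j ℓ b a with slot v ≡ᵇ a
    ... | true  = refl
    ... | false = suc≤ᵇsuc (ρ ℓ b) j

    redPairs : ℕ → ℕ
    redPairs k = ∑ N (λ ℓ → ∑ K (λ b → ∑ N (λ ℓ' → ∑ K (λ b' →
      𝟙 (adjLayer ℓ ℓ') * (𝟙 (ρ ℓ b ≤ᵇ k) * 𝟙 (ρ ℓ' b' ≤ᵇ k))))))

    redPairs≡ : ∀ k → k ≤ C₁ → redPairs k ≡ 2 * (2 * adjacentClosed k)
    redPairs≡ k k≤C₁ = begin
      redPairs k
        ≡⟨ ∑-cong N (λ ℓ _ → ∑-swap K N (λ b ℓ' → ∑ K (λ b' → 𝟙 (adjLayer ℓ ℓ') * (near ℓ b * near ℓ' b')))) ⟩
      ∑ N (λ ℓ → ∑ N (λ ℓ' → ∑ K (λ b → ∑ K (λ b' → 𝟙 (adjLayer ℓ ℓ') * (near ℓ b * near ℓ' b')))))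
        ≡⟨ ∑-cong N (λ ℓ _ → ∑-cong N (λ ℓ' _ → ∑-product K (𝟙 (adjLayer ℓ ℓ')) (near ℓ) (near ℓ'))) ⟩
      ∑ N (λ ℓ → ∑ N (λ ℓ' → 𝟙 (adjLayer ℓ ℓ') * (∑ K (near ℓ) * ∑ K (near ℓ'))))
        ≡⟨ ∑-cong N (λ ℓ _ → ∑-cong N (λ ℓ' _ → cong₂ (λ x y → 𝟙 (adjLayer ℓ ℓ') * (x * y))
             (∑-blocks (layerDist (layer v) ℓ) k) (∑-blocks (layerDist (layer v) ℓ') k))) ⟩
      ∑ N (λ ℓ → ∑ N (λ ℓ' → 𝟙 (adjLayer ℓ ℓ') * (width ℓ * width ℓ')))
        ≡⟨ ∑-adjLayer-pairs (layer v) (λ p → blockCount k ∣ p - C ∣) ⟩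
      2 * ∑ N (λ p → blockCount k ∣ p - C ∣ * blockCount k ∣ next p - C ∣)
        ≡⟨ cong (2 *_) (∑-∣-C∣-next (blockCount k) (cong (λ s → 𝟙 s * K) (≥⇒<ᵇ≡false k≤C₁))) ⟩
      2 * (2 * adjacentCount C k)
        ≡⟨ cong (λ x → 2 * (2 * x)) (adjacentCount-closed C₁ k (m≤n⇒m≤1+n k≤C₁)) ⟩
      2 * (2 * adjacentClosed k) ∎
      where
        open ≡-Reasoning
        near : ℕ → ℕ → ℕ
        near ℓ b = 𝟙 (ρ ℓ b ≤ᵇ k)
        width : ℕ → ℕ
        width ℓ = blockCount k (layerDist (layer v) ℓ)

    𝟙-∧-true-∧ : ∀ x y z → 𝟙 ((x ∧ true) ∧ (y ∧ z)) ≡ 𝟙 x * (𝟙 y * 𝟙 z)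
    𝟙-∧-true-∧ x y z rewrite ∧-identityʳ x = trans (𝟙-∧ x (y ∧ z)) (cong (𝟙 x *_) (𝟙-∧ y z))

    2e-c2 : ∀ j → suc j ≤ C₁ →
      2 * e graph colouring c2 (suc j) v ≡ 2 * (2 * adjacentClosed (suc j)) + (M ∸ 1) * (2 * (2 * adjacentClosed j))
    2e-c2 j sj≤C₁ = begin
      2 * e graph colouring c2 (suc j) v
        ≡⟨ 2e≡∑ᶠ∑ᶠ c2 (suc j) v ⟩
      ∑ᶠ {n} (λ x → ∑ᶠ {n} (λ y → 𝟙 (edgeInBall c2 (suc j) v x y)))
        ≡⟨ ∑ᶠ-cong {n} (λ x → ∑ᶠ-cong {n} (λ y → cong 𝟙 (edgeInBall-c2 (suc j) v x y))) ⟩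
      ∑ᶠ {n} (λ x → ∑ᶠ {n} (λ y → 𝟙 (red x y ∧ ((dist v x ≤ᵇ suc j) ∧ (dist v y ≤ᵇ suc j)))))
        ≡⟨ ∑ᶠ²-coordinates (λ ℓ b a ℓ' b' a' → 𝟙 ((adjLayer ℓ ℓ' ∧ (a ≡ᵇ a')) ∧ inside ℓ b a ℓ' b' a')) ⟩
      ∑ᶜ (λ ℓ b a → ∑ᶜ (λ ℓ' b' a' → 𝟙 ((adjLayer ℓ ℓ' ∧ (a ≡ᵇ a')) ∧ inside ℓ b a ℓ' b' a')))
        ≡⟨ ∑-cong N (λ ℓ _ → ∑-cong K (λ b _ → ∑-cong M (λ a a<M → sameSlot ℓ b a a<M))) ⟩
      ∑ N (λ ℓ → ∑ K (λ b → ∑ M (λ a → Z a ℓ b)))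
        ≡⟨ ∑-cong N (λ ℓ _ → ∑-swap K M (λ b a → Z a ℓ b)) ⟩
      ∑ N (λ ℓ → ∑ M (λ a → ∑ K (Z a ℓ)))
        ≡⟨ ∑-swap N M (λ ℓ a → ∑ K (Z a ℓ)) ⟩
      ∑ M (λ a → redPairs (threshold j (slot v ≡ᵇ a)))
        ≡⟨ ∑-≡ᵇ M (slot v) (redPairs ∘ threshold j) (toℕ<n (slotᶠ v)) ⟩
      redPairs (suc j) + (M ∸ 1) * redPairs j
        ≡⟨ cong₂ (λ x y → x + (M ∸ 1) * y) (redPairs≡ (suc j) sj≤C₁) (redPairs≡ j (<⇒≤ sj≤C₁)) ⟩
      2 * (2 * adjacentClosed (suc j)) + (M ∸ 1) * (2 * (2 * adjacentClosed j)) ∎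
      where
        open ≡-Reasoning
        inside : ℕ → ℕ → ℕ → ℕ → ℕ → ℕ → Bool
        inside ℓ b a ℓ' b' a' = within (suc j) ℓ b a ∧ within (suc j) ℓ' b' a'
        Z : ℕ → ℕ → ℕ → ℕ
        Z a ℓ b = ∑ N (λ ℓ' → ∑ K (λ b' → let k = threshold j (slot v ≡ᵇ a) in
          𝟙 (adjLayer ℓ ℓ') * (𝟙 (ρ ℓ b ≤ᵇ k) * 𝟙 (ρ ℓ' b' ≤ᵇ k))))
        sameSlot : ∀ ℓ b a → a < M →
          ∑ᶜ (λ ℓ' b' a' → 𝟙 ((adjLayer ℓ ℓ' ∧ (a ≡ᵇ a')) ∧ inside ℓ b a ℓ' b' a')) ≡ Z a ℓ b
        sameSlot ℓ b a a<M = ∑-cong N (λ ℓ' _ → ∑-cong K (λ b' _ → begin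
          ∑ M (λ a' → 𝟙 ((adjLayer ℓ ℓ' ∧ (a ≡ᵇ a')) ∧ inside ℓ b a ℓ' b' a'))
            ≡⟨ ∑-at M a (λ a' s → 𝟙 ((adjLayer ℓ ℓ' ∧ s) ∧ inside ℓ b a ℓ' b' a')) a<M
                 (λ a' → cong (λ s → 𝟙 (s ∧ inside ℓ b a ℓ' b' a')) (∧-zeroʳ (adjLayer ℓ ℓ'))) ⟩
          𝟙 ((adjLayer ℓ ℓ' ∧ true) ∧ inside ℓ b a ℓ' b' a)
            ≡⟨ 𝟙-∧-true-∧ (adjLayer ℓ ℓ') (within (suc j) ℓ b a) (within (suc j) ℓ' b' a) ⟩
          𝟙 (adjLayer ℓ ℓ') * (𝟙 (within (suc j) ℓ b a) * 𝟙 (within (suc j) ℓ' b' a))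
            ≡⟨ cong₂ (λ x y → 𝟙 (adjLayer ℓ ℓ') * (𝟙 x * 𝟙 y)) (within-suc j ℓ b a) (within-suc j ℓ' b' a) ⟩
          𝟙 (adjLayer ℓ ℓ') * (𝟙 (ρ ℓ b ≤ᵇ threshold j (slot v ≡ᵇ a)) * 𝟙 (ρ ℓ' b' ≤ᵇ threshold j (slot v ≡ᵇ a))) ∎))

<-by-difference : ∀ a b p → b ≡ a + suc p → a < b
<-by-difference a b p eq = subst (a <_) (sym eq) (m<m+n a (s≤s z≤n))

-- Twice the colour-2 and twice the colour-1 edge counts of a ball of radius
-- j + 1 (see 2e-c2 and 2e-c1 below, with M = 2K).  Each case is settled by
-- writing K = 2 + j + d and exhibiting the difference as a polynomial in d.
colour2<colour1 : ∀ K j → 2 + j ≤ K → let open BlockCount K in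
  2 * (2 * adjacentClosed (suc j)) + (2 * K ∸ 1) * (2 * (2 * adjacentClosed j))
    < 2 * K * (2 * K ∸ 1) * (centreCount j + 2 * (j * K))
colour2<colour1 K zero le with m≤n⇒∃[o]m+o≡n le
... | d , refl = <-by-difference _ _ _ (solve 1 (λ d →
      let K = con 2 :+ d
          L = (con 1 :+ d) :+ ((con 2 :+ d) :+ con 0)
      in (con 2 :* K :* L) :* (con 1 :+ con 2 :* (con 0 :* K))
         := (con 2 :* (con 2 :* (con 1 :* K :+ con 0 :* (K :* K))) :+ L :* (con 2 :* (con 2 :* con 0)))
            :+ (con 1 :+ (con 3 :+ con 10 :* d :+ con 4 :* d :* d))) refl d)
colour2<colour1 K (suc zero) le with m≤n⇒∃[o]m+o≡n le
... | d , refl = <-by-difference _ _ _ (solve 1 (λ d →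
      let K = con 3 :+ d
          L = (con 2 :+ d) :+ ((con 3 :+ d) :+ con 0)
      in (con 2 :* K :* L) :* (con 1 :+ con 2 :* (con 1 :* K))
         := (con 2 :* (con 2 :* (K :* K :+ con 1 :* (K :* K)))
              :+ L :* (con 2 :* (con 2 :* (con 1 :* K :+ con 0 :* (K :* K)))))
            :+ (con 1 :+ (con 77 :+ con 122 :* d :+ con 56 :* d :* d :+ con 8 :* d :* d :* d))) refl d)
colour2<colour1 K (suc (suc m)) le with m≤n⇒∃[o]m+o≡n le
... | d , refl = <-by-difference _ _ _ (solve 2 (λ m d →
      let K = con 4 :+ m :+ d
          L = (con 3 :+ (m :+ d)) :+ (K :+ con 0)
      in (con 2 :* K :* L) :* (K :+ con 2 :* ((con 2 :+ m) :* K))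
         := (con 2 :* (con 2 :* (K :* K :+ (con 2 :+ m) :* (K :* K)))
              :+ L :* (con 2 :* (con 2 :* (K :* K :+ (con 1 :+ m) :* (K :* K)))))
            :+ (con 1 :+ (con 2 :* (con 3 :+ m :+ d) :* (con 5 :+ m :+ d) :+ con 1 :+ con 4 :* d :* K :* K)))
      refl m d)

n<2^n : ∀ n → n < 2 ^ n
n<2^n zero    = s≤s z≤n
n<2^n (suc n) = +-mono-≤ (m^n>0 2 n) (subst (suc n ≤_) (sym (+-identityʳ (2 ^ n))) (n<2^n n))

theorem6p1 : (s t : ℕ) → 1 ≤ t → t < s →
    Σ ℕ λ n → 1 ≤ n × Σ (Graph n) λ G → Σ (EdgeColouring G) λ f →
      IsFlipGraph G f t (2 ^ s ∸ 1) (2 ^ s)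
-- The construction works for t = 0 as well.
theorem6p1 (suc s₁) t _ (s≤s t≤s₁) = n , 1≤n , graph , colouring , degree-c1 , degree-c2 , fewerColour2
  where
    K = 2 ^ s₁
    open Construction t K (2 * K)

    1≤n : 1 ≤ n
    1≤n = *-mono-≤ {1} {N * K} (*-mono-≤ {1} {N} (s≤s z≤n) (m^n>0 2 s₁)) (m^n>0 2 (suc s₁))

    t<K : t < K
    t<K = ≤-<-trans t≤s₁ (n<2^n s₁)

    fewerColour2 : ∀ v j → 1 ≤ j → j ≤ t → e graph colouring c2 j v < e graph colouring c1 j v
    fewerColour2 v (suc j) _ j<t =
      *-cancelˡ-< 2 _ _ (subst₂ _<_ (sym (2e-c2 j j<t)) (sym (2e-c1 j j≤C)) (colour2<colour1 K j 2+j≤K))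
      where
        open AroundVertex v
        j≤C : j ≤ C
        j≤C = ≤-trans (n≤1+n j) (m≤n⇒m≤1+n j<t)
        2+j≤K : 2 + j ≤ K
        2+j≤K = ≤-trans (s≤s j<t) t<K
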